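{- Let $k\ge1$, let $\lambda$ be a partition with empty $k$-core and let $(\lambda^0,\dots,\lambda^{k-1})$ be its $k$-quotient. For a partition $\mu$ let $c(\mu)$ be the multiset of contents of the cells of $\mu$, and for $0\le r<k$ let $c_{r,k}(\lambda)$ be the multiset of contents $c(x)$ of cells $x\in\lambda$ with $k\mid c(x)+r$. Then for every $0\le r<k$, as multisets, \[ \tfrac{1}{k}\bigl(c_{r,k}(\lambda)+r\bigr) = \bigcup_{0\le i<k-r} c(\lambda^i)\ \cup \bigcup_{k-r\le i<k}\bigl(c(\lambda^i)+1\bigr). \]
   Context: Contents: the content of a cell in row $a$ and column $b$ (English notation) is $b-a$. For a multiset $X$ and a number $k$, $X+k=\{\{x+k:x\in X\}\}$ and $kX=\{\{kx:x\in X\}\}$; unions are multiset unions. The $k$-core of $\lambda$ is obtained by successively removing border strips (connected skew shapes without $2\times2$ square) of size $k$ as long as possible. The $k$-quotient: append zero parts to $\lambda$ so that the number $\ell$ of rows is divisible by $k$; encode the lower-right boundary of the diagram as a word $w_0w_1w_2\cdots$ read from the bottom-left corner to the top-right corner, with $0$ for a north (vertical) step and $1$ for an east (horizontal) step. For $0\le s<k$, $\lambda^s$ is the partition whose boundary word (in the same encoding) is $w_sw_{s+k}w_{s+2k}\cdots$; $(\lambda^0,\dots,\lambda^{k-1})$ is the $k$-quotient. -}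

module Defs where

open import Data.Nat using (ℕ; zero; suc; _+_; _∸_; _<_; _<ᵇ_; _≟_; NonZero)
open import Data.Nat.DivMod using (_%_)
open import Data.Bool using (Bool; true; false; if_then_else_)
open import Data.Integer as ℤ using (ℤ; +_)
open import Data.Integer.DivMod using (_/ℕ_)
open import Data.Integer.Divisibility.Signed using (_∣?_)
open import Data.Nat.ListAction using (sum)
open import Data.List using (List; []; _∷_; _++_; length; map; filter; concat; concatMap; upTo; zip; zipWith; reverse; replicate)
open import Data.Product using (_×_; _,_; proj₁; proj₂; ∃; ∃-syntax)
open import Data.Sum using (_⊎_)
open import Relation.Nullary using (¬_)
open import Relation.Nullary.Decidable using (¬?)
open import Relation.Binary.PropositionalEquality using (_≡_)
open import Relation.Binary.Construct.Closure.ReflexiveTransitive using (Star)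

data Decreasing : List ℕ → Set where
  dnil  : Decreasing []
  dsing : ∀ a → Decreasing (a ∷ [])
  dcons : ∀ {a b l} → b Data.Nat.≤ a → Decreasing (b ∷ l) → Decreasing (a ∷ b ∷ l)

data AllPos : List ℕ → Set where
  pnil  : AllPos []
  pcons : ∀ {a l} → 0 < a → AllPos l → AllPos (a ∷ l)

IsPartition : List ℕ → Set
IsPartition λ′ = Decreasing λ′ × AllPos λ′

size : List ℕ → ℕ
size = sum

-- i-th part (rows indexed from 0), 0 beyond the last row
part : List ℕ → ℕ → ℕ
part []      _       = 0
part (a ∷ _) zero    = a
part (_ ∷ l) (suc i) = part l i

-- Cells (row a, column b), both indexed from 0

Cell : Set
Cell = ℕ × ℕ

_∈λ_ : Cell → List ℕ → Set
(a , b) ∈λ λ′ = b < part λ′ a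

SkewCell : List ℕ → List ℕ → Cell → Set
SkewCell λ′ μ c = c ∈λ λ′ × ¬ (c ∈λ μ)

Adjacent : Cell → Cell → Set
Adjacent (a , b) (a′ , b′) =
  (a ≡ a′ × (suc b ≡ b′ ⊎ b ≡ suc b′)) ⊎ (b ≡ b′ × (suc a ≡ a′ ⊎ a ≡ suc a′))

data Path (S : Cell → Set) : Cell → Cell → Set where
  stop : ∀ {c} → S c → Path S c c
  step : ∀ {c d e} → S c → Adjacent c d → Path S d e → Path S c e

Connected : (Cell → Set) → Set
Connected S = ∀ c d → S c → S d → Path S c d

No2x2 : (Cell → Set) → Set
No2x2 S = ¬ (∃[ a ] ∃[ b ] (S (a , b) × S (a , suc b) × S (suc a , b) × S (suc a , suc b)))

_⊆λ_ : List ℕ → List ℕ → Set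
μ ⊆λ λ′ = ∀ c → c ∈λ μ → c ∈λ λ′

RemoveBorderStrip : ℕ → List ℕ → List ℕ → Set
RemoveBorderStrip k λ′ μ =
  IsPartition μ × μ ⊆λ λ′ × size λ′ ≡ size μ + k ×
  Connected (SkewCell λ′ μ) × No2x2 (SkewCell λ′ μ)

EmptyCore : ℕ → List ℕ → Set
EmptyCore k λ′ = Star (RemoveBorderStrip k) λ′ []

-- Contents (content of cell (a,b) is b - a), as a list (= multiset)

rowContents : ℕ → ℕ → List ℤ
rowContents a n = map (λ b → (+ b) ℤ.- (+ a)) (upTo n)

contents : List ℕ → List ℤ
contents λ′ = concat (zipWith rowContents (upTo (length λ′)) λ′)

contentsMod : ℕ → ℕ → List ℕ → List ℤ
contentsMod k r λ′ = filter (λ x → (+ k) ∣? (x ℤ.+ + r)) (contents λ′)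

-- k-quotient via boundary words (true = east step 1, false = north step 0)

-- pad with zero parts so that the number of rows is divisible by k
padZeros : (k : ℕ) → .{{NonZero k}} → List ℕ → List ℕ
padZeros k λ′ = λ′ ++ replicate ((k ∸ (length λ′ % k)) % k) 0

-- boundary word, read from the bottom-left to the top-right corner,
-- given the parts listed from bottom to top
wordFromBottom : ℕ → List ℕ → List Bool
wordFromBottom prev []      = []
wordFromBottom prev (p ∷ l) = replicate (p ∸ prev) true ++ (false ∷ wordFromBottom p l)

boundaryWord : List ℕ → List Bool
boundaryWord λ′ = wordFromBottom 0 (reverse λ′)

-- decoding a word: each 0 (north step) is a row whose length is the
-- number of 1s before it; rows come out bottom to top.
decodeFromBottom : ℕ → List Bool → List ℕ
decodeFromBottom n []          = []
decodeFromBottom n (true ∷ w)  = decodeFromBottom (suc n) w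
decodeFromBottom n (false ∷ w) = n ∷ decodeFromBottom n w

fromWord : List Bool → List ℕ
fromWord w = filter (λ n → ¬? (n ≟ 0)) (reverse (decodeFromBottom 0 w))

subword : (k : ℕ) → .{{NonZero k}} → ℕ → List Bool → List Bool
subword k s w = map proj₂ (filter (λ p → (proj₁ p % k) ≟ s) (zip (upTo (length w)) w))

quotient : (k : ℕ) → .{{NonZero k}} → List ℕ → ℕ → List ℕ
quotient k λ′ s = fromWord (subword k s (boundaryWord (padZeros k λ′)))

lhs : (k : ℕ) → .{{NonZero k}} → ℕ → List ℕ → List ℤ
lhs k r λ′ = map (λ x → (x ℤ.+ + r) /ℕ k) (contentsMod k r λ′)

rhs : (k : ℕ) → .{{NonZero k}} → ℕ → List ℕ → List ℤ
rhs k r λ′ = concatMap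
  (λ i → if i <ᵇ (k ∸ r)
           then contents (quotient k λ′ i)
           else map (λ x → x ℤ.+ ℤ.1ℤ) (contents (quotient k λ′ i)))
  (upTo k)

-- Let W be the boundary word of λ′ padded to k L rows; its subwords Wˢ (letters at positions ≡ s mod k) are the
-- boundary words of the quotient components λˢ. For a boundary word w with ℓ north steps, the number of cells of
-- content x plus max(x, 0) is the number of east steps among the first x + ℓ letters of w (continued by east steps).
-- The first k a + t letters of W are the first a + [s < t] letters of each Wˢ, so once every Wˢ has exactly L north
-- steps, the cells of content q k − r in λ′ are counted by those of content q in λˢ for s < k − r and of content q − 1
-- for the other s, which is the identity. The empty k-core gives this balance: a border strip of size k is connected
-- and has no 2×2 square, so its contents are k consecutive integers, one in each class mod k. Hence the number of
-- cells of λ′ with content in a class t does not depend on t, while the difference between the classes t + 1 and t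
-- is L minus the number of north steps of Wᵗ.

module Submission where

open import Defs
open import Data.Bool using (Bool; true; false; if_then_else_)
open import Data.Empty using (⊥-elim)
open import Data.Integer as ℤ using (ℤ; +_; -[1+_])
import Data.Integer.Properties as ℤₚ
open import Data.Integer.Tactic.RingSolver using (solve-∀)
open import Data.List
  using (List; []; _∷_; [_]; _++_; _∷ʳ_; applyUpTo; concat; concatMap; filter; length; map; replicate; reverse; upTo; zip; zipWith)
import Data.List.Properties as List
open import Data.List.Membership.Propositional using (_∈_)
open import Data.List.Membership.Propositional.Properties using (∈-∃++)
open import Data.List.Relation.Unary.Any using (here; there)
open import Data.List.Relation.Unary.All as All using (All; []; _∷_)
import Data.List.Relation.Unary.All.Properties as AllP
open import Data.List.Relation.Unary.Linked using (Linked; []; [-]; _∷_)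
open import Data.List.Relation.Binary.Permutation.Propositional using (_↭_; prep; ↭-refl; ↭-sym; ↭-trans)
open import Data.List.Relation.Binary.Permutation.Propositional.Properties using (shift)
open import Data.Nat
open import Data.Nat.DivMod using (_%_; _/_; m%n<n; m<n⇒m%n≡m; [m+n]%n≡m%n; m*n/n≡m; m*n%n≡0; n%n≡0; m≡m%n+[m/n]*n)
open import Data.Integer.DivMod using (_/ℕ_)
open import Data.Integer.Divisibility.Signed using (_∣?_; divides)
open import Data.Nat.Properties
import Data.Nat.Tactic.RingSolver as ℕ-Solver
open import Algebra.Properties.CommutativeSemigroup +-commutativeSemigroup
  using (interchange; x∙yz≈y∙xz; xy∙z≈y∙xz; xy∙z≈xz∙y)
open import Data.Product using (_,_; _×_; proj₁; proj₂; ∃-syntax)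
open import Data.Sum using (_⊎_; inj₁; inj₂)
open import Function using (_∘_; id)
open import Relation.Binary.PropositionalEquality hiding ([_])
open import Relation.Nullary using (Dec; yes; no; ¬_)
open import Relation.Nullary.Decidable using (¬?)
open import Relation.Binary.Definitions using (tri<; tri≈; tri>)
open import Relation.Binary.Construct.Closure.ReflexiveTransitive using (ε; _◅_)

δ : ℤ → ℤ → ℕ
δ x y with x ℤ.≟ y
... | yes _ = 1
... | no _ = 0

δ-refl : ∀ x → δ x x ≡ 1
δ-refl x with x ℤ.≟ x
... | yes _ = refl
... | no x≢x = ⊥-elim (x≢x refl)

δ-≢ : ∀ {x y} → x ≢ y → δ x y ≡ 0
δ-≢ {x} {y} x≢y with x ℤ.≟ y
... | yes x≡y = ⊥-elim (x≢y x≡y)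
... | no _ = refl

δ-cong : ∀ {x y x′ y′} → (x ≡ y → x′ ≡ y′) → (x′ ≡ y′ → x ≡ y) → δ x y ≡ δ x′ y′
δ-cong {x} {y} {x′} {y′} to from with x ℤ.≟ y | x′ ℤ.≟ y′
... | yes _ | yes _ = refl
... | no _ | no _ = refl
... | yes e | no ne = ⊥-elim (ne (to e))
... | no ne | yes e = ⊥-elim (ne (from e))

δ-sym : ∀ x y → δ x y ≡ δ y x
δ-sym x y = δ-cong sym sym

[x+c]-c≡x : ∀ x c → x ℤ.+ c ℤ.- c ≡ x
[x+c]-c≡x = solve-∀

[x-c]+c≡x : ∀ x c → x ℤ.- c ℤ.+ c ≡ x
[x-c]+c≡x = solve-∀

+m-+n≡+[m∸n] : ∀ {m n} → n ≤ m → + m ℤ.- + n ≡ + (m ∸ n)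
+m-+n≡+[m∸n] {m} {n} n≤m = trans (ℤₚ.m-n≡m⊖n m n) (ℤₚ.⊖-≥ n≤m)

+m-+n<0 : ∀ {m n} → m < n → ∃[ d ] + m ℤ.- + n ≡ -[1+ d ]
+m-+n<0 {m} {suc n} (s≤s m≤n) =
  n ∸ m , trans (ℤₚ.m-n≡m⊖n m (suc n)) (trans (ℤₚ.⊖-< (s≤s m≤n)) (cong (λ z → ℤ.- (+ z)) (+-∸-assoc 1 m≤n)))

δ-+ : ∀ x y c → δ (x ℤ.+ c) y ≡ δ x (y ℤ.- c)
δ-+ x y c = δ-cong (λ e → trans (sym ([x+c]-c≡x x c)) (cong (ℤ._- c) e)) (λ e → trans (cong (ℤ._+ c) e) ([x-c]+c≡x y c))

count : ℤ → List ℤ → ℕ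
count x [] = 0
count x (y ∷ ys) = δ x y + count x ys

count-++ : ∀ x xs ys → count x (xs ++ ys) ≡ count x xs + count x ys
count-++ x [] ys = refl
count-++ x (y ∷ xs) ys = trans (cong (_+_ (δ x y)) (count-++ x xs ys)) (sym (+-assoc (δ x y) _ _))

count>0⇒∈ : ∀ x xs → 0 < count x xs → x ∈ xs
count>0⇒∈ x (y ∷ xs) pos with x ℤ.≟ y
... | yes x≡y = here x≡y
... | no _ = there (count>0⇒∈ x xs pos)

count-map-+ : ∀ c x xs → count x (map (ℤ._+ c) xs) ≡ count (x ℤ.- c) xs
count-map-+ c x [] = refl
count-map-+ c x (y ∷ xs) =
  cong₂ _+_ (trans (δ-sym x (y ℤ.+ c)) (trans (δ-+ y x c) (δ-sym y (x ℤ.- c)))) (count-map-+ c x xs)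

count⇒↭ : ∀ (xs ys : List ℤ) → (∀ x → count x xs ≡ count x ys) → xs ↭ ys
count⇒↭ [] [] _ = ↭-refl
count⇒↭ [] (y ∷ ys) same with trans (same y) (cong (_+ count y ys) (δ-refl y))
... | ()
count⇒↭ (x ∷ xs) ys same with ∈-∃++ (count>0⇒∈ x ys x-in-ys)
  where
  x-in-ys : 0 < count x ys
  x-in-ys = subst (0 <_) (trans (cong (_+ count x xs) (sym (δ-refl x))) (same x)) (s≤s z≤n)
... | us , vs , refl = ↭-trans (prep x (count⇒↭ xs (us ++ vs) rest)) (↭-sym (shift x us vs))
  where
  rest : ∀ z → count z xs ≡ count z (us ++ vs)
  rest z = +-cancelˡ-≡ (δ z x) _ _ (begin
    δ z x + count z xs                   ≡⟨ same z ⟩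
    count z (us ++ x ∷ vs)               ≡⟨ count-++ z us (x ∷ vs) ⟩
    count z us + (δ z x + count z vs)    ≡⟨ x∙yz≈y∙xz (count z us) (δ z x) _ ⟩
    δ z x + (count z us + count z vs)    ≡⟨ cong (_+_ (δ z x)) (sym (count-++ z us vs)) ⟩
    δ z x + count z (us ++ vs)           ∎)
    where open ≡-Reasoning

𝟙[_<_] : ℕ → ℕ → ℕ
𝟙[ m < zero ] = 0
𝟙[ zero < suc n ] = 1
𝟙[ suc m < suc n ] = 𝟙[ m < n ]

𝟙<-yes : ∀ {m n} → m < n → 𝟙[ m < n ] ≡ 1
𝟙<-yes {zero} {suc n} _ = refl
𝟙<-yes {suc m} {suc n} (s≤s m<n) = 𝟙<-yes m<n

𝟙<-no : ∀ {m n} → n ≤ m → 𝟙[ m < n ] ≡ 0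
𝟙<-no {m} {zero} _ = refl
𝟙<-no {suc m} {suc n} (s≤s n≤m) = 𝟙<-no n≤m

𝟙<≤1 : ∀ m n → 𝟙[ m < n ] ≤ 1
𝟙<≤1 m n with m <? n
... | yes m<n = ≤-reflexive (𝟙<-yes m<n)
... | no m≮n = ≤-trans (≤-reflexive (𝟙<-no (≮⇒≥ m≮n))) z≤n

𝟙<-suc : ∀ m n → 𝟙[ m < suc n ] ≡ 𝟙[ m < n ] + δ (+ m) (+ n)
𝟙<-suc m n with <-cmp m n
... | tri< m<n _ _ =
  trans (𝟙<-yes (m≤n⇒m≤1+n m<n)) (sym (cong₂ _+_ (𝟙<-yes m<n) (δ-≢ (<⇒≢ m<n ∘ ℤₚ.+-injective))))
... | tri≈ _ refl _ = trans (𝟙<-yes (n<1+n m)) (sym (cong₂ _+_ (𝟙<-no (≤-refl {m})) (δ-refl (+ m))))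
... | tri> _ _ n<m =
  trans (𝟙<-no n<m) (sym (cong₂ _+_ (𝟙<-no (<⇒≤ n<m)) (δ-≢ (<⇒≢ n<m ∘ sym ∘ ℤₚ.+-injective))))

𝟙<≡if : ∀ m n → 𝟙[ m < n ] ≡ (if m <ᵇ n then 1 else 0)
𝟙<≡if m zero = refl
𝟙<≡if zero (suc n) = refl
𝟙<≡if (suc m) (suc n) = 𝟙<≡if m n

𝟙[0≤_<_] : ℤ → ℕ → ℕ
𝟙[0≤ + m < n ] = 𝟙[ m < n ]
𝟙[0≤ -[1+ _ ] < n ] = 0

𝟙[0≤<]-zero : ∀ y → 𝟙[0≤ y < 0 ] ≡ 0
𝟙[0≤<]-zero (+ m) = refl
𝟙[0≤<]-zero -[1+ m ] = refl

𝟙[0≤<]-suc : ∀ y n → 𝟙[0≤ y < suc n ] ≡ 𝟙[0≤ y < n ] + δ y (+ n)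
𝟙[0≤<]-suc (+ m) n = 𝟙<-suc m n
𝟙[0≤<]-suc -[1+ m ] n = refl

𝟙[0≤<]≤1 : ∀ y n → 𝟙[0≤ y < n ] ≤ 1
𝟙[0≤<]≤1 (+ m) n = 𝟙<≤1 m n
𝟙[0≤<]≤1 -[1+ m ] n = z≤n

𝟙[0≤<]-mono : ∀ y {m n} → m ≤ n → 𝟙[0≤ y < m ] ≤ 𝟙[0≤ y < n ]
𝟙[0≤<]-mono (+ j) {m} m≤n with j <? m
... | yes j<m = ≤-reflexive (trans (𝟙<-yes j<m) (sym (𝟙<-yes (<-≤-trans j<m m≤n))))
... | no j≮m = ≤-trans (≤-reflexive (𝟙<-no (≮⇒≥ j≮m))) z≤n
𝟙[0≤<]-mono -[1+ j ] _ = z≤n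

_⁺ : ℤ → ℕ
(+ n) ⁺ = n
-[1+ _ ] ⁺ = 0

∑< : ℕ → (ℕ → ℕ) → ℕ
∑< zero f = 0
∑< (suc n) f = ∑< n f + f n

syntax ∑< n (λ i → e) = ∑[ i < n ] e

∑-cong : ∀ {f g} n → (∀ i → i < n → f i ≡ g i) → ∑< n f ≡ ∑< n g
∑-cong zero _ = refl
∑-cong (suc n) f≡g = cong₂ _+_ (∑-cong n (λ i i<n → f≡g i (m≤n⇒m≤1+n i<n))) (f≡g n (n<1+n n))

∑-zero : ∀ n → ∑[ i < n ] 0 ≡ 0
∑-zero zero = refl
∑-zero (suc n) = trans (+-identityʳ _) (∑-zero n)

∑-const : ∀ c n → ∑[ i < n ] c ≡ n * c
∑-const c zero = refl
∑-const c (suc n) = trans (cong (_+ c) (∑-const c n)) (+-comm (n * c) c)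

∑-+ : ∀ f g n → ∑[ i < n ] (f i + g i) ≡ ∑< n f + ∑< n g
∑-+ f g zero = refl
∑-+ f g (suc n) = trans (cong (_+ (f n + g n)) (∑-+ f g n)) (interchange (∑< n f) (∑< n g) (f n) (g n))

∑-split : ∀ f m n → ∑< (m + n) f ≡ ∑< m f + ∑[ i < n ] f (m + i)
∑-split f m zero = trans (cong (λ z → ∑< z f) (+-identityʳ m)) (sym (+-identityʳ _))
∑-split f m (suc n) =
  trans (cong (λ z → ∑< z f) (+-suc m n)) (trans (cong (_+ f (m + n)) (∑-split f m n)) (+-assoc (∑< m f) _ _))

∑-swap : ∀ (f : ℕ → ℕ → ℕ) m n → ∑[ i < m ] ∑< n (f i) ≡ ∑[ j < n ] ∑[ i < m ] f i j
∑-swap f zero n = sym (∑-zero n)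
∑-swap f (suc m) n = trans (cong (_+ ∑< n (f m)) (∑-swap f m n)) (sym (∑-+ _ _ n))

∑-mono : ∀ {f g} n → (∀ i → i < n → f i ≤ g i) → ∑< n f ≤ ∑< n g
∑-mono zero _ = z≤n
∑-mono (suc n) f≤g = +-mono-≤ (∑-mono n (λ i i<n → f≤g i (m≤n⇒m≤1+n i<n))) (f≤g n (n<1+n n))

∑-mono-range : ∀ f {m n} → m ≤ n → ∑< m f ≤ ∑< n f
∑-mono-range f {m} {n} m≤n = begin
  ∑< m f                          ≤⟨ m≤m+n (∑< m f) _ ⟩
  ∑< m f + ∑[ i < n ∸ m ] f (m + i) ≡⟨ sym (∑-split f m (n ∸ m)) ⟩
  ∑< (m + (n ∸ m)) f              ≡⟨ cong (λ z → ∑< z f) (m+[n∸m]≡n m≤n) ⟩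
  ∑< n f                          ∎
  where open ≤-Reasoning

term≤∑ : ∀ f {i n} → i < n → f i ≤ ∑< n f
term≤∑ f {i} {n} i<n = ≤-trans (m≤n+m (f i) (∑< i f)) (∑-mono-range f i<n)

∑-zero-prefix : ∀ f m n → (∀ i → i < m → f i ≡ 0) → ∑< (m + n) f ≡ ∑[ i < n ] f (m + i)
∑-zero-prefix f m n zeros = trans (∑-split f m n) (cong (_+ ∑[ i < n ] f (m + i)) (trans (∑-cong m zeros) (∑-zero m)))

∑-shift : ∀ f n → f 0 ≡ 0 → ∑[ i < n ] f (suc i) ≡ ∑< n f + f n
∑-shift f n f0≡0 = sym (∑-zero-prefix f 1 n (λ { zero _ → f0≡0 ; (suc _) (s≤s ()) }))

∑-residues : ∀ f k a → ∑< (k * a) f ≡ ∑[ t < k ] ∑[ i < a ] f (k * i + t)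
∑-residues f k zero = trans (cong (λ z → ∑< z f) (*-zeroʳ k)) (sym (∑-zero k))
∑-residues f k (suc a) = begin
  ∑< (k * suc a) f                                   ≡⟨ cong (λ z → ∑< z f) (trans (*-suc k a) (+-comm k (k * a))) ⟩
  ∑< (k * a + k) f                                   ≡⟨ ∑-split f (k * a) k ⟩
  ∑< (k * a) f + ∑[ t < k ] f (k * a + t)            ≡⟨ cong (_+ ∑[ t < k ] f (k * a + t)) (∑-residues f k a) ⟩
  ∑[ t < k ] ∑[ i < a ] f (k * i + t) + ∑[ t < k ] f (k * a + t) ≡⟨ sym (∑-+ _ _ k) ⟩
  ∑[ t < k ] ∑[ i < suc a ] f (k * i + t)            ∎
  where open ≡-Reasoning

∑-δ : ∀ t b n → ∑[ s < n ] (δ (+ t) (+ s) * b) ≡ 𝟙[ t < n ] * b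
∑-δ t b zero = refl
∑-δ t b (suc n) = begin
  ∑[ s < n ] (δ (+ t) (+ s) * b) + δ (+ t) (+ n) * b ≡⟨ cong (_+ δ (+ t) (+ n) * b) (∑-δ t b n) ⟩
  𝟙[ t < n ] * b + δ (+ t) (+ n) * b                 ≡⟨ sym (*-distribʳ-+ b 𝟙[ t < n ] _) ⟩
  (𝟙[ t < n ] + δ (+ t) (+ n)) * b                   ≡⟨ cong (_* b) (sym (𝟙<-suc t n)) ⟩
  𝟙[ t < suc n ] * b                                 ∎
  where open ≡-Reasoning

∑-𝟙< : ∀ p n → p ≤ n → ∑[ i < n ] 𝟙[ i < p ] ≡ p
∑-𝟙< p n p≤n = begin
  ∑[ i < n ] 𝟙[ i < p ]
    ≡⟨ cong (λ z → ∑[ i < z ] 𝟙[ i < p ]) (sym (m+[n∸m]≡n p≤n)) ⟩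
  ∑[ i < p + (n ∸ p) ] 𝟙[ i < p ]
    ≡⟨ ∑-split _ p (n ∸ p) ⟩
  ∑[ i < p ] 𝟙[ i < p ] + ∑[ i < n ∸ p ] 𝟙[ p + i < p ]
    ≡⟨ cong₂ _+_ (∑-cong p (λ _ → 𝟙<-yes)) (∑-cong (n ∸ p) (λ i _ → 𝟙<-no (m≤m+n p i))) ⟩
  ∑[ i < p ] 1 + ∑[ i < n ∸ p ] 0
    ≡⟨ cong₂ _+_ (trans (∑-const 1 p) (*-identityʳ p)) (∑-zero (n ∸ p)) ⟩
  p + 0
    ≡⟨ +-identityʳ p ⟩
  p ∎
  where open ≡-Reasoning

∑≤n : ∀ f n → (∀ i → i < n → f i ≤ 1) → ∑< n f ≤ n
∑≤n f n f≤1 = ≤-trans (∑-mono n f≤1) (≤-reflexive (trans (∑-const 1 n) (*-identityʳ n)))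

∑≡n⇒≡1 : ∀ f n → (∀ i → i < n → f i ≤ 1) → ∑< n f ≡ n → ∀ i → i < n → f i ≡ 1
∑≡n⇒≡1 f (suc n) f≤1 ∑≡1+n = each
  where
  below : ∀ j → j < n → f j ≤ 1
  below j j<n = f≤1 j (m≤n⇒m≤1+n j<n)
  ∑≡n : ∑< n f ≡ n
  ∑≡n = ≤-antisym (∑≤n f n below) (+-cancelʳ-≤ 1 n (∑< n f) (begin
    n + 1        ≡⟨ trans (+-comm n 1) (sym ∑≡1+n) ⟩
    ∑< n f + f n ≤⟨ +-monoʳ-≤ (∑< n f) (f≤1 n (n<1+n n)) ⟩
    ∑< n f + 1   ∎))
    where open ≤-Reasoning
  last≡1 : f n ≡ 1
  last≡1 = +-cancelˡ-≡ (∑< n f) _ _ (trans ∑≡1+n (trans (+-comm 1 n) (cong (_+ 1) (sym ∑≡n))))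
  each : ∀ i → i < suc n → f i ≡ 1
  each i i<1+n with i ≟ n
  ... | yes refl = last≡1
  ... | no i≢n = ∑≡n⇒≡1 f n below ∑≡n i (≤∧≢⇒< (≤-pred i<1+n) i≢n)

∑>0⇒∃ : ∀ f n → 0 < ∑< n f → ∃[ i ] i < n × 0 < f i
∑>0⇒∃ f (suc n) pos with f n in eq
... | suc _ = n , n<1+n n , subst (0 <_) (sym eq) (s≤s z≤n)
... | zero with ∑>0⇒∃ f n (subst (0 <_) (+-identityʳ _) pos)
...   | i , i<n , fi>0 = i , m≤n⇒m≤1+n i<n , fi>0

∑>1⇒∃₂ : ∀ f n → (∀ i → i < n → f i ≤ 1) → 1 < ∑< n f → ∃[ i ] ∃[ j ] i < j × j < n × 0 < f i × 0 < f j
∑>1⇒∃₂ f (suc n) f≤1 big with f n in eq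
... | zero with ∑>1⇒∃₂ f n (λ i i<n → f≤1 i (m≤n⇒m≤1+n i<n)) (subst (1 <_) (+-identityʳ _) big)
...   | i , j , i<j , j<n , fi , fj = i , j , i<j , m≤n⇒m≤1+n j<n , fi , fj
∑>1⇒∃₂ f (suc n) f≤1 big | suc zero with ∑>0⇒∃ f n (+-cancelʳ-≤ 1 1 (∑< n f) big)
...   | i , i<n , fi = i , n , i<n , n<1+n n , fi , subst (0 <_) (sym eq) (s≤s z≤n)
∑>1⇒∃₂ f (suc n) f≤1 big | suc (suc _) with s≤s () ← subst (_≤ 1) eq (f≤1 n (n<1+n n))

run≤∑ : ∀ f n j m → j + m < n → (∀ i → i ≤ m → 0 < f (j + i)) → suc m ≤ ∑< n f
run≤∑ f n j m j+m<n run = begin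
  suc m                              ≡⟨ sym (trans (∑-const 1 (suc m)) (*-identityʳ (suc m))) ⟩
  ∑[ i < suc m ] 1                   ≤⟨ ∑-mono (suc m) (λ i i<1+m → run i (≤-pred i<1+m)) ⟩
  ∑[ i < suc m ] f (j + i)           ≤⟨ m≤n+m _ (∑< j f) ⟩
  ∑< j f + ∑[ i < suc m ] f (j + i)  ≡⟨ sym (∑-split f j (suc m)) ⟩
  ∑< (j + suc m) f                   ≤⟨ ∑-mono-range f (≤-trans (≤-reflexive (+-suc j m)) j+m<n) ⟩
  ∑< n f                             ∎
  where open ≤-Reasoning

∑-update : ∀ f g t n → t < n → (∀ s → s < n → s ≢ t → g s ≡ f s) → ∑< n g + f t ≡ ∑< n f + g t
∑-update f g t (suc n) t<1+n agree with t ≟ n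
... | yes refl = begin
  ∑< t g + g t + f t ≡⟨ cong (λ z → z + g t + f t) (∑-cong t (λ s s<t → agree s (m≤n⇒m≤1+n s<t) (<⇒≢ s<t))) ⟩
  ∑< t f + g t + f t ≡⟨ xy∙z≈xz∙y (∑< t f) (g t) (f t) ⟩
  ∑< t f + f t + g t ∎
  where open ≡-Reasoning
... | no t≢n = begin
  ∑< n g + g n + f t ≡⟨ xy∙z≈xz∙y (∑< n g) (g n) (f t) ⟩
  ∑< n g + f t + g n ≡⟨ cong₂ _+_ (∑-update f g t n t<n (λ s s<n → agree s (m≤n⇒m≤1+n s<n)))
                                 (agree n (n<1+n n) (t≢n ∘ sym)) ⟩
  ∑< n f + g t + f n ≡⟨ xy∙z≈xz∙y (∑< n f) (g t) (f n) ⟩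
  ∑< n f + f n + g t ∎
  where
  open ≡-Reasoning
  t<n = ≤∧≢⇒< (≤-pred t<1+n) t≢n

-- Counting cells of a given content

count-rowContents : ∀ x a n → count x (rowContents a n) ≡ 𝟙[0≤ x ℤ.+ + a < n ]
count-rowContents x a zero = sym (𝟙[0≤<]-zero (x ℤ.+ + a))
count-rowContents x a (suc n) = begin
  count x (map f (upTo (suc n)))                 ≡⟨ cong (count x ∘ map f) (sym (List.upTo-∷ʳ n)) ⟩
  count x (map f (upTo n ++ [ n ]))              ≡⟨ cong (count x) (List.map-++ f (upTo n) [ n ]) ⟩
  count x (rowContents a n ++ [ f n ])           ≡⟨ count-++ x (rowContents a n) [ f n ] ⟩
  count x (rowContents a n) + (δ x (f n) + 0)    ≡⟨ cong₂ _+_ (count-rowContents x a n)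
                                                               (trans (+-identityʳ _) (sym (δ-+ x (+ n) (+ a)))) ⟩
  𝟙[0≤ x ℤ.+ + a < n ] + δ (x ℤ.+ + a) (+ n)     ≡⟨ sym (𝟙[0≤<]-suc (x ℤ.+ + a) n) ⟩
  𝟙[0≤ x ℤ.+ + a < suc n ]                       ∎
  where
  open ≡-Reasoning
  f : ℕ → ℤ
  f b = + b ℤ.- + a

count-contents : ∀ μ x → count x (contents μ) ≡ ∑[ a < length μ ] 𝟙[0≤ x ℤ.+ + a < part μ a ]
count-contents μ x = shifted id μ
  where
  shifted : ∀ f μ → count x (concat (zipWith rowContents (applyUpTo f (length μ)) μ))
                    ≡ ∑[ a < length μ ] 𝟙[0≤ x ℤ.+ + f a < part μ a ]
  shifted f [] = refl
  shifted f (p ∷ μ) = begin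
    count x (rowContents (f 0) p ++ concat (zipWith rowContents (applyUpTo (f ∘ suc) (length μ)) μ))
      ≡⟨ count-++ x (rowContents (f 0) p) _ ⟩
    count x (rowContents (f 0) p) + count x (concat (zipWith rowContents (applyUpTo (f ∘ suc) (length μ)) μ))
      ≡⟨ cong₂ _+_ (count-rowContents x (f 0) p) (shifted (f ∘ suc) μ) ⟩
    𝟙[0≤ x ℤ.+ + f 0 < p ] + ∑[ a < length μ ] 𝟙[0≤ x ℤ.+ + f (suc a) < part μ a ]
      ≡⟨ sym (∑-split (λ a → 𝟙[0≤ x ℤ.+ + f a < part (p ∷ μ) a ]) 1 (length μ)) ⟩
    ∑[ a < suc (length μ) ] 𝟙[0≤ x ℤ.+ + f a < part (p ∷ μ) a ] ∎
    where open ≡-Reasoning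

part-beyond : ∀ μ {a} → length μ ≤ a → part μ a ≡ 0
part-beyond [] _ = refl
part-beyond (p ∷ μ) {suc a} (s≤s len≤a) = part-beyond μ len≤a

count-contents-≤ : ∀ μ x {n} → length μ ≤ n →
  count x (contents μ) ≡ ∑[ a < n ] 𝟙[0≤ x ℤ.+ + a < part μ a ]
count-contents-≤ μ x {n} len≤n = begin
  count x (contents μ)                         ≡⟨ count-contents μ x ⟩
  ∑< (length μ) g                              ≡⟨ sym (+-identityʳ _) ⟩
  ∑< (length μ) g + 0                          ≡⟨ cong (_+_ (∑< (length μ) g)) (sym beyond) ⟩
  ∑< (length μ) g + ∑[ i < n ∸ length μ ] g (length μ + i) ≡⟨ sym (∑-split g (length μ) (n ∸ length μ)) ⟩
  ∑< (length μ + (n ∸ length μ)) g             ≡⟨ cong (λ m → ∑< m g) (m+[n∸m]≡n len≤n) ⟩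
  ∑< n g                                       ∎
  where
  open ≡-Reasoning
  g = λ a → 𝟙[0≤ x ℤ.+ + a < part μ a ]
  beyond : ∑[ i < n ∸ length μ ] g (length μ + i) ≡ 0
  beyond = trans (∑-cong (n ∸ length μ) (λ i _ →
             trans (cong 𝟙[0≤ x ℤ.+ + (length μ + i) <_] (part-beyond μ (m≤m+n (length μ) i)))
                   (𝟙[0≤<]-zero (x ℤ.+ + (length μ + i)))))
           (∑-zero (n ∸ length μ))

count-contents-cong : ∀ μ ν → (∀ a → part μ a ≡ part ν a) → ∀ x → count x (contents μ) ≡ count x (contents ν)
count-contents-cong μ ν same x = begin
  count x (contents μ)                   ≡⟨ count-contents-≤ μ x (m≤m+n (length μ) (length ν)) ⟩
  ∑[ a < n ] 𝟙[0≤ x ℤ.+ + a < part μ a ] ≡⟨ ∑-cong n (λ a _ → cong 𝟙[0≤ x ℤ.+ + a <_] (same a)) ⟩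
  ∑[ a < n ] 𝟙[0≤ x ℤ.+ + a < part ν a ] ≡⟨ sym (count-contents-≤ ν x (m≤n+m (length ν) (length μ))) ⟩
  count x (contents ν)                   ∎
  where
  open ≡-Reasoning
  n = length μ + length ν

part-++-replicate-0 : ∀ μ m a → part (μ ++ replicate m 0) a ≡ part μ a
part-++-replicate-0 [] zero a = refl
part-++-replicate-0 [] (suc m) zero = refl
part-++-replicate-0 [] (suc m) (suc a) = part-++-replicate-0 [] m a
part-++-replicate-0 (p ∷ μ) m zero = refl
part-++-replicate-0 (p ∷ μ) m (suc a) = part-++-replicate-0 μ m a

part-∷ʳ-< : ∀ μ p {a} → a < length μ → part (μ ∷ʳ p) a ≡ part μ a
part-∷ʳ-< (q ∷ μ) p {zero} _ = refl
part-∷ʳ-< (q ∷ μ) p {suc a} (s≤s a<len) = part-∷ʳ-< μ p a<len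

part-∷ʳ-length : ∀ μ p → part (μ ∷ʳ p) (length μ) ≡ p
part-∷ʳ-length [] p = refl
part-∷ʳ-length (q ∷ μ) p = part-∷ʳ-length μ p

count-contents-∷ʳ : ∀ μ p x → count x (contents (μ ∷ʳ p)) ≡ count x (contents μ) + 𝟙[0≤ x ℤ.+ + length μ < p ]
count-contents-∷ʳ μ p x = begin
  count x (contents (μ ∷ʳ p))
    ≡⟨ count-contents-≤ (μ ∷ʳ p) x (≤-reflexive (trans (List.length-++ μ) (+-comm (length μ) 1))) ⟩
  ∑< (length μ) g + g (length μ)
    ≡⟨ cong₂ _+_ (∑-cong (length μ) (λ a a<len → cong 𝟙[0≤ x ℤ.+ + a <_] (part-∷ʳ-< μ p a<len)))
                 (cong 𝟙[0≤ x ℤ.+ + length μ <_] (part-∷ʳ-length μ p)) ⟩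
  ∑[ a < length μ ] 𝟙[0≤ x ℤ.+ + a < part μ a ] + 𝟙[0≤ x ℤ.+ + length μ < p ]
    ≡⟨ cong (_+ 𝟙[0≤ x ℤ.+ + length μ < p ]) (sym (count-contents μ x)) ⟩
  count x (contents μ) + 𝟙[0≤ x ℤ.+ + length μ < p ] ∎
  where
  open ≡-Reasoning
  g = λ a → 𝟙[0≤ x ℤ.+ + a < part (μ ∷ʳ p) a ]

-- Boundary words

bit : Bool → ℕ
bit true = 1
bit false = 0

-- The east steps among the first p steps of w, the path being continued by east steps forever.
easts : List Bool → ℕ → ℕ
easts [] p = p
easts (_ ∷ _) zero = 0
easts (b ∷ w) (suc p) = bit b + easts w p

norths : List Bool → ℕ
norths [] = 0
norths (true ∷ w) = norths w
norths (false ∷ w) = suc (norths w)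

easts-zero : ∀ w → easts w 0 ≡ 0
easts-zero [] = refl
easts-zero (_ ∷ _) = refl

easts-replicate : ∀ n p → easts (replicate n true) p ≡ p
easts-replicate zero p = refl
easts-replicate (suc n) zero = refl
easts-replicate (suc n) (suc p) = cong suc (easts-replicate n p)

easts-north : ∀ n w m → easts (replicate n true ++ false ∷ w) (suc m) ≡ 𝟙[ m < n ] + easts (replicate n true ++ w) m
easts-north zero w m = refl
easts-north (suc n) w zero = cong suc (easts-zero (replicate n true ++ false ∷ w))
easts-north (suc n) w (suc m) = trans (cong suc (easts-north n w m)) (sym (+-suc 𝟙[ m < n ] _))

easts-north-ℤ : ∀ n w y →
  easts (replicate n true ++ false ∷ w) ((ℤ.1ℤ ℤ.+ y) ⁺) ≡ 𝟙[0≤ y < n ] + easts (replicate n true ++ w) (y ⁺)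
easts-north-ℤ n w (+ m) = easts-north n w m
easts-north-ℤ n w -[1+ zero ] = trans (easts-zero (replicate n true ++ false ∷ w)) (sym (easts-zero (replicate n true ++ w)))
easts-north-ℤ n w -[1+ suc _ ] = trans (easts-zero (replicate n true ++ false ∷ w)) (sym (easts-zero (replicate n true ++ w)))

easts+norths : ∀ w p → length w ≤ p → easts w p + norths w ≡ p
easts+norths [] p _ = +-identityʳ p
easts+norths (true ∷ w) (suc p) (s≤s len≤p) = cong suc (easts+norths w p len≤p)
easts+norths (false ∷ w) (suc p) (s≤s len≤p) = trans (+-suc (easts w p) (norths w)) (cong suc (easts+norths w p len≤p))

length-decode : ∀ n w → length (decodeFromBottom n w) ≡ norths w
length-decode n [] = refl
length-decode n (true ∷ w) = length-decode (suc n) w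
length-decode n (false ∷ w) = cong suc (length-decode n w)

decode-replicate : ∀ p m w → decodeFromBottom p (replicate m true ++ w) ≡ decodeFromBottom (p + m) w
decode-replicate p zero w = cong (λ q → decodeFromBottom q w) (sym (+-identityʳ p))
decode-replicate p (suc m) w = trans (decode-replicate (suc p) m w) (cong (λ q → decodeFromBottom q w) (sym (+-suc p m)))

replicate-∷ : ∀ n (w : List Bool) → replicate n true ++ true ∷ w ≡ replicate (suc n) true ++ w
replicate-∷ zero w = refl
replicate-∷ (suc n) w = cong (true ∷_) (replicate-∷ n w)

count-contents-reverse-∷ : ∀ p d x →
  count x (contents (reverse (p ∷ d))) ≡ count x (contents (reverse d)) + 𝟙[0≤ x ℤ.+ + length d < p ]
count-contents-reverse-∷ p d x = begin
  count x (contents (reverse (p ∷ d)))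
    ≡⟨ cong (count x ∘ contents) (List.unfold-reverse p d) ⟩
  count x (contents (reverse d ∷ʳ p))
    ≡⟨ count-contents-∷ʳ (reverse d) p x ⟩
  count x (contents (reverse d)) + 𝟙[0≤ x ℤ.+ + length (reverse d) < p ]
    ≡⟨ cong (λ n → count x (contents (reverse d)) + 𝟙[0≤ x ℤ.+ + n < p ]) (List.length-reverse d) ⟩
  count x (contents (reverse d)) + 𝟙[0≤ x ℤ.+ + length d < p ] ∎
  where open ≡-Reasoning

count-contents-decode : ∀ n w x →
  count x (contents (reverse (decodeFromBottom n w))) + x ⁺ ≡ easts (replicate n true ++ w) ((x ℤ.+ + norths w) ⁺)
count-contents-decode n [] x =
  sym (trans (cong₂ easts (List.++-identityʳ (replicate n true)) (cong _⁺ (ℤₚ.+-identityʳ x))) (easts-replicate n (x ⁺)))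
count-contents-decode n (true ∷ w) x =
  trans (count-contents-decode (suc n) w x) (cong (λ v → easts v ((x ℤ.+ + norths w) ⁺)) (sym (replicate-∷ n w)))
count-contents-decode n (false ∷ w) x = begin
  count x (contents (reverse (n ∷ d))) + x ⁺
    ≡⟨ cong (_+ x ⁺) (count-contents-reverse-∷ n d x) ⟩
  c + 𝟙[0≤ x ℤ.+ + length d < n ] + x ⁺
    ≡⟨ cong (λ h → c + 𝟙[0≤ x ℤ.+ + h < n ] + x ⁺) (length-decode n w) ⟩
  c + 𝟙[0≤ y < n ] + x ⁺
    ≡⟨ xy∙z≈y∙xz c 𝟙[0≤ y < n ] (x ⁺) ⟩
  𝟙[0≤ y < n ] + (c + x ⁺)
    ≡⟨ cong (_+_ 𝟙[0≤ y < n ]) (count-contents-decode n w x) ⟩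
  𝟙[0≤ y < n ] + easts (replicate n true ++ w) (y ⁺)
    ≡⟨ sym (easts-north-ℤ n w y) ⟩
  easts (replicate n true ++ false ∷ w) ((ℤ.1ℤ ℤ.+ y) ⁺)
    ≡⟨ cong (λ z → easts (replicate n true ++ false ∷ w) (z ⁺)) (+-1+ x (+ norths w)) ⟩
  easts (replicate n true ++ false ∷ w) ((x ℤ.+ + suc (norths w)) ⁺) ∎
  where
  open ≡-Reasoning
  d = decodeFromBottom n w
  c = count x (contents (reverse d))
  y = x ℤ.+ + norths w
  +-1+ : ∀ (x h : ℤ) → ℤ.1ℤ ℤ.+ (x ℤ.+ h) ≡ x ℤ.+ (ℤ.1ℤ ℤ.+ h)
  +-1+ = solve-∀

linked-∷ʳ : ∀ {p d a} → Linked _≤_ (p ∷ d) → All (_≤ a) (p ∷ d) → Linked _≤_ ((p ∷ d) ∷ʳ a)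
linked-∷ʳ [-] (p≤a ∷ []) = p≤a ∷ [-]
linked-∷ʳ (p≤q ∷ rest) (_ ∷ below) = p≤q ∷ linked-∷ʳ rest below

all-below-head : ∀ {a μ} → Decreasing (a ∷ μ) → All (_≤ a) μ
all-below-head (dsing a) = []
all-below-head (dcons b≤a dec) = b≤a ∷ All.map (λ c≤b → ≤-trans c≤b b≤a) (all-below-head dec)

All-reverse : ∀ {P : ℕ → Set} μ → All P μ → All P (reverse μ)
All-reverse [] [] = []
All-reverse (a ∷ μ) (pa ∷ pμ) = subst (All _) (sym (List.unfold-reverse a μ)) (AllP.∷ʳ⁺ (All-reverse μ pμ) pa)

ascending-reverse : ∀ μ → Decreasing μ → Linked _≤_ (0 ∷ reverse μ)
ascending-reverse [] _ = [-]
ascending-reverse (a ∷ μ) dec = subst (λ d → Linked _≤_ (0 ∷ d)) (sym (List.unfold-reverse a μ))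
  (linked-∷ʳ (ascending-reverse μ (tail dec)) (z≤n ∷ All-reverse μ (all-below-head dec)))
  where
  tail : ∀ {a μ} → Decreasing (a ∷ μ) → Decreasing μ
  tail (dsing _) = dnil
  tail (dcons _ dec) = dec

decreasing-padded : ∀ μ m → Decreasing μ → Decreasing (μ ++ replicate m 0)
decreasing-padded [] m _ = zeros m
  where
  zeros : ∀ m → Decreasing (replicate m 0)
  zeros zero = dnil
  zeros (suc zero) = dsing 0
  zeros (suc (suc m)) = dcons z≤n (zeros (suc m))
decreasing-padded (a ∷ []) zero dec = dec
decreasing-padded (a ∷ []) (suc m) _ = dcons z≤n (decreasing-padded [] (suc m) dnil)
decreasing-padded (a ∷ b ∷ μ) m (dcons b≤a dec) = dcons b≤a (decreasing-padded (b ∷ μ) m dec)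

decode-wordFromBottom : ∀ p d → Linked _≤_ (p ∷ d) → decodeFromBottom p (wordFromBottom p d) ≡ d
decode-wordFromBottom p [] _ = refl
decode-wordFromBottom p (q ∷ d) (p≤q ∷ rest) = begin
  decodeFromBottom p (replicate (q ∸ p) true ++ false ∷ wordFromBottom q d)
    ≡⟨ decode-replicate p (q ∸ p) _ ⟩
  decodeFromBottom (p + (q ∸ p)) (false ∷ wordFromBottom q d)
    ≡⟨ cong (λ n → decodeFromBottom n (false ∷ wordFromBottom q d)) (m+[n∸m]≡n p≤q) ⟩
  q ∷ decodeFromBottom q (wordFromBottom q d)
    ≡⟨ cong (q ∷_) (decode-wordFromBottom q d rest) ⟩
  q ∷ d ∎
  where open ≡-Reasoning

norths-wordFromBottom : ∀ p d → norths (wordFromBottom p d) ≡ length d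
norths-wordFromBottom p [] = refl
norths-wordFromBottom p (q ∷ d) = trans (skip (q ∸ p)) (cong suc (norths-wordFromBottom q d))
  where
  skip : ∀ m → norths (replicate m true ++ false ∷ wordFromBottom q d) ≡ suc (norths (wordFromBottom q d))
  skip zero = refl
  skip (suc m) = skip m

norths-boundaryWord : ∀ μ → norths (boundaryWord μ) ≡ length μ
norths-boundaryWord μ = trans (norths-wordFromBottom 0 (reverse μ)) (List.length-reverse μ)

length-wordFromBottom : ∀ p d B → Linked _≤_ (p ∷ d) → All (_≤ B) d → p ≤ B →
  length (wordFromBottom p d) + p ≤ length d + B
length-wordFromBottom p [] B _ [] p≤B = p≤B
length-wordFromBottom p (q ∷ d) B (p≤q ∷ rest) (q≤B ∷ d≤B) _ = begin
  length (replicate (q ∸ p) true ++ false ∷ wordFromBottom q d) + p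
                                                                   ≡⟨ cong (_+ p) (trans (List.length-++ (replicate (q ∸ p) true)) east-run) ⟩
  (q ∸ p) + suc ℓ + p                                              ≡⟨ ring (q ∸ p) ℓ p ⟩
  suc (ℓ + ((q ∸ p) + p))                                          ≡⟨ cong (λ z → suc (ℓ + z)) (m∸n+n≡m p≤q) ⟩
  suc (ℓ + q)                                                      ≤⟨ s≤s (length-wordFromBottom q d B rest d≤B q≤B) ⟩
  suc (length d + B)                                               ∎
  where
  open ≤-Reasoning
  ℓ = length (wordFromBottom q d)
  east-run : length (replicate (q ∸ p) true) + suc ℓ ≡ (q ∸ p) + suc ℓ
  east-run = cong (_+ suc ℓ) (List.length-replicate (q ∸ p))
  ring : ∀ a b c → a + suc b + c ≡ suc (b + (a + c))
  ring = ℕ-Solver.solve-∀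

length-boundaryWord : ∀ μ B → Decreasing μ → All (_≤ B) μ → length (boundaryWord μ) ≤ length μ + B
length-boundaryWord μ B dec μ≤B = begin
  length (boundaryWord μ)                  ≡⟨ sym (+-identityʳ _) ⟩
  length (boundaryWord μ) + 0              ≤⟨ length-wordFromBottom 0 (reverse μ) B (ascending-reverse μ dec) (All-reverse μ μ≤B) z≤n ⟩
  length (reverse μ) + B                   ≡⟨ cong (_+ B) (List.length-reverse μ) ⟩
  length μ + B                             ∎
  where open ≤-Reasoning

count-contents-boundaryWord : ∀ μ → Decreasing μ → ∀ x →
  count x (contents μ) + x ⁺ ≡ easts (boundaryWord μ) ((x ℤ.+ + length μ) ⁺)
count-contents-boundaryWord μ dec x = begin
  count x (contents μ) + x ⁺
    ≡⟨ cong (λ ν → count x (contents ν) + x ⁺) (sym (List.reverse-involutive μ)) ⟩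
  count x (contents (reverse (reverse μ))) + x ⁺
    ≡⟨ cong (λ ν → count x (contents (reverse ν)) + x ⁺)
            (sym (decode-wordFromBottom 0 (reverse μ) (ascending-reverse μ dec))) ⟩
  count x (contents (reverse (decodeFromBottom 0 w))) + x ⁺
    ≡⟨ count-contents-decode 0 w x ⟩
  easts w ((x ℤ.+ + norths w) ⁺)
    ≡⟨ cong (λ n → easts w ((x ℤ.+ + n) ⁺)) (norths-boundaryWord μ) ⟩
  easts w ((x ℤ.+ + length μ) ⁺) ∎
  where
  open ≡-Reasoning
  w = boundaryWord μ

reverse-replicate : ∀ {A : Set} m (x : A) → reverse (replicate m x) ≡ replicate m x
reverse-replicate zero x = refl
reverse-replicate (suc m) x = trans (List.unfold-reverse x (replicate m x)) (trans (cong (_∷ʳ x) (reverse-replicate m x)) (snoc m))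
  where
  snoc : ∀ m → replicate m x ∷ʳ x ≡ x ∷ replicate m x
  snoc zero = refl
  snoc (suc m) = cong (x ∷_) (snoc m)

decode-split : ∀ w → ∃[ m ] ∃[ e ] decodeFromBottom 0 w ≡ replicate m 0 ++ e × All (0 <_) e
decode-split [] = 0 , [] , refl , []
decode-split (true ∷ w) = 0 , decodeFromBottom 1 w , refl , at-least 1 w
  where
  at-least : ∀ n w → All (n ≤_) (decodeFromBottom n w)
  at-least n [] = []
  at-least n (true ∷ w) = All.map (≤-trans (n≤1+n n)) (at-least (suc n) w)
  at-least n (false ∷ w) = ≤-refl ∷ at-least n w
decode-split (false ∷ w) with decode-split w
... | m , e , eq , pos = suc m , e , cong (0 ∷_) eq , pos

reverse-decode : ∀ w → ∃[ m ] reverse (decodeFromBottom 0 w) ≡ fromWord w ++ replicate m 0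
reverse-decode w with decode-split w
... | m , e , eq , pos = m , trans rows (cong (_++ replicate m 0) (sym drop-empty))
  where
  open ≡-Reasoning
  nonzero? = λ (n : ℕ) → ¬? (n ≟ 0)
  rows : reverse (decodeFromBottom 0 w) ≡ reverse e ++ replicate m 0
  rows = begin
    reverse (decodeFromBottom 0 w)       ≡⟨ cong reverse eq ⟩
    reverse (replicate m 0 ++ e)         ≡⟨ List.reverse-++ (replicate m 0) e ⟩
    reverse e ++ reverse (replicate m 0) ≡⟨ cong (reverse e ++_) (reverse-replicate m 0) ⟩
    reverse e ++ replicate m 0           ∎
  empty : ∀ m → All (λ n → ¬ ¬ n ≡ 0) (replicate m 0)
  empty zero = []
  empty (suc m) = (λ n≢0 → n≢0 refl) ∷ empty m
  drop-empty : fromWord w ≡ reverse e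
  drop-empty = begin
    filter nonzero? (reverse (decodeFromBottom 0 w))               ≡⟨ cong (filter nonzero?) rows ⟩
    filter nonzero? (reverse e ++ replicate m 0)                   ≡⟨ List.filter-++ nonzero? (reverse e) (replicate m 0) ⟩
    filter nonzero? (reverse e) ++ filter nonzero? (replicate m 0)
      ≡⟨ cong₂ _++_ (List.filter-all nonzero? (All-reverse e (All.map >⇒≢ pos))) (List.filter-none nonzero? (empty m)) ⟩
    reverse e ++ []                                                ≡⟨ List.++-identityʳ (reverse e) ⟩
    reverse e                                                      ∎

count-contents-fromWord : ∀ w x → count x (contents (fromWord w)) + x ⁺ ≡ easts w ((x ℤ.+ + norths w) ⁺)
count-contents-fromWord w x with reverse-decode w
... | m , eq = trans (cong (_+ x ⁺) unpad) (count-contents-decode 0 w x)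
  where
  unpad : count x (contents (fromWord w)) ≡ count x (contents (reverse (decodeFromBottom 0 w)))
  unpad = trans (count-contents-cong (fromWord w) (fromWord w ++ replicate m 0) (λ a → sym (part-++-replicate-0 (fromWord w) m a)) x)
                (cong (count x ∘ contents) (sym eq))

-- Splitting a word into its k subwords

module Subwords (k : ℕ) .{{_ : NonZero k}} where

  -- subword k s = subwordAt id s; in general the letter at position i is labelled f i instead of i.
  subwordAt : (ℕ → ℕ) → ℕ → List Bool → List Bool
  subwordAt f s w = map proj₂ (filter (λ p → (proj₁ p % k) ≟ s) (zip (applyUpTo f (length w)) w))

  subwordAt-hit : ∀ s f b w → f 0 % k ≡ s → subwordAt f s (b ∷ w) ≡ b ∷ subwordAt (f ∘ suc) s w
  subwordAt-hit s f b w hit = cong (map proj₂) (List.filter-accept (λ p → (proj₁ p % k) ≟ s) hit)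

  subwordAt-miss : ∀ s f b w → f 0 % k ≢ s → subwordAt f s (b ∷ w) ≡ subwordAt (f ∘ suc) s w
  subwordAt-miss s f b w miss = cong (map proj₂) (List.filter-reject (λ p → (proj₁ p % k) ≟ s) miss)

  length-subwordAt : ∀ s f w → length (subwordAt f s w) ≤ length w
  length-subwordAt s f [] = z≤n
  length-subwordAt s f (b ∷ w) with (f 0 % k) ≟ s
  ... | yes hit rewrite subwordAt-hit s f b w hit = s≤s (length-subwordAt s (f ∘ suc) w)
  ... | no miss rewrite subwordAt-miss s f b w miss = m≤n⇒m≤1+n (length-subwordAt s (f ∘ suc) w)

  length-subword : ∀ s w → length (subword k s w) ≤ length w
  length-subword s = length-subwordAt s id

  inClass : ℕ → (ℕ → ℕ) → ℕ
  inClass s f = δ (+ (f 0 % k)) (+ s)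

  residueCount : ℕ → (ℕ → ℕ) → ℕ → ℕ
  residueCount s f zero = 0
  residueCount s f (suc p) = inClass s f + residueCount s (f ∘ suc) p

  ∑-inClass : ∀ f b → ∑[ s < k ] (inClass s f * b) ≡ b
  ∑-inClass f b = trans (∑-δ (f 0 % k) b k) (trans (cong (_* b) (𝟙<-yes (m%n<n (f 0) k))) (+-identityʳ b))

  ∑-residueCount : ∀ f p → ∑[ s < k ] residueCount s f p ≡ p
  ∑-residueCount f zero = ∑-zero k
  ∑-residueCount f (suc p) = begin
    ∑[ s < k ] (inClass s f + residueCount s (f ∘ suc) p)           ≡⟨ ∑-+ _ _ k ⟩
    ∑[ s < k ] inClass s f + ∑[ s < k ] residueCount s (f ∘ suc) p  ≡⟨ cong₂ _+_ one (∑-residueCount (f ∘ suc) p) ⟩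
    suc p                                                           ∎
    where
    open ≡-Reasoning
    one : ∑[ s < k ] inClass s f ≡ 1
    one = trans (∑-cong k (λ s _ → sym (*-identityʳ _))) (∑-inClass f 1)

  easts-subwordAt-∷ : ∀ s f b w q →
    easts (subwordAt f s (b ∷ w)) (inClass s f + q) ≡ inClass s f * bit b + easts (subwordAt (f ∘ suc) s w) q
  easts-subwordAt-∷ s f b w q = by-cases ((f 0 % k) ≟ s)
    where
    open ≡-Reasoning
    rest = easts (subwordAt (f ∘ suc) s w) q
    by-cases : Dec (f 0 % k ≡ s) → easts (subwordAt f s (b ∷ w)) (inClass s f + q) ≡ inClass s f * bit b + rest
    by-cases (yes hit) = begin
      easts (subwordAt f s (b ∷ w)) (inClass s f + q) ≡⟨ cong₂ easts (subwordAt-hit s f b w hit) (cong (_+ q) in≡1) ⟩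
      bit b + rest                                    ≡⟨ cong (_+ rest) (sym (trans (cong (_* bit b) in≡1) (+-identityʳ _))) ⟩
      inClass s f * bit b + rest                      ∎
      where
      in≡1 : inClass s f ≡ 1
      in≡1 = trans (cong (λ r → δ (+ r) (+ s)) hit) (δ-refl (+ s))
    by-cases (no miss) = begin
      easts (subwordAt f s (b ∷ w)) (inClass s f + q) ≡⟨ cong₂ easts (subwordAt-miss s f b w miss) (cong (_+ q) in≡0) ⟩
      rest                                            ≡⟨ cong (_+ rest) (sym (cong (_* bit b) in≡0)) ⟩
      inClass s f * bit b + rest                      ∎
      where
      in≡0 : inClass s f ≡ 0
      in≡0 = δ-≢ (miss ∘ ℤₚ.+-injective)

  easts-subwords : ∀ f w p → easts w p ≡ ∑[ s < k ] easts (subwordAt f s w) (residueCount s f p)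
  easts-subwords f [] p = sym (∑-residueCount f p)
  easts-subwords f (b ∷ w) zero = sym (trans (∑-cong k (λ s _ → easts-zero (subwordAt f s (b ∷ w)))) (∑-zero k))
  easts-subwords f (b ∷ w) (suc p) = begin
    bit b + easts w p
      ≡⟨ cong₂ _+_ (sym (∑-inClass f (bit b))) (easts-subwords (f ∘ suc) w p) ⟩
    ∑[ s < k ] (inClass s f * bit b) + ∑[ s < k ] easts (subwordAt (f ∘ suc) s w) (residueCount s (f ∘ suc) p)
      ≡⟨ sym (∑-+ _ _ k) ⟩
    ∑[ s < k ] (inClass s f * bit b + easts (subwordAt (f ∘ suc) s w) (residueCount s (f ∘ suc) p))
      ≡⟨ ∑-cong k (λ s _ → sym (easts-subwordAt-∷ s f b w (residueCount s (f ∘ suc) p))) ⟩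
    ∑[ s < k ] easts (subwordAt f s (b ∷ w)) (residueCount s f (suc p)) ∎
    where open ≡-Reasoning

  residueCount-cong : ∀ s f g p → (∀ i → f i % k ≡ g i % k) → residueCount s f p ≡ residueCount s g p
  residueCount-cong s f g zero _ = refl
  residueCount-cong s f g (suc p) f≡g =
    cong₂ _+_ (cong (λ r → δ (+ r) (+ s)) (f≡g 0)) (residueCount-cong s (f ∘ suc) (g ∘ suc) p (f≡g ∘ suc))

  residueCount-+ : ∀ s f m p → residueCount s f (m + p) ≡ residueCount s f m + residueCount s (λ i → f (m + i)) p
  residueCount-+ s f zero p = refl
  residueCount-+ s f (suc m) p =
    trans (cong (_+_ (inClass s f)) (residueCount-+ s (f ∘ suc) m p)) (sym (+-assoc (inClass s f) _ _))

  residueCount-≤ : ∀ s t → t ≤ k → residueCount s id t ≡ 𝟙[ s < t ]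
  residueCount-≤ s zero _ = refl
  residueCount-≤ s (suc t) t<k = begin
    residueCount s id (suc t)                             ≡⟨ cong (residueCount s id) (+-comm 1 t) ⟩
    residueCount s id (t + 1)                             ≡⟨ residueCount-+ s id t 1 ⟩
    residueCount s id t + (δ (+ ((t + 0) % k)) (+ s) + 0) ≡⟨ cong₂ _+_ (residueCount-≤ s t (<⇒≤ t<k)) (+-identityʳ _) ⟩
    𝟙[ s < t ] + δ (+ ((t + 0) % k)) (+ s)                ≡⟨ cong (λ r → 𝟙[ s < t ] + δ (+ r) (+ s)) t%k≡t ⟩
    𝟙[ s < t ] + δ (+ t) (+ s)                            ≡⟨ cong (_+_ 𝟙[ s < t ]) (δ-sym (+ t) (+ s)) ⟩
    𝟙[ s < t ] + δ (+ s) (+ t)                            ≡⟨ sym (𝟙<-suc s t) ⟩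
    𝟙[ s < suc t ]                                        ∎
    where
    open ≡-Reasoning
    t%k≡t : (t + 0) % k ≡ t
    t%k≡t = trans (cong (_% k) (+-identityʳ t)) (m<n⇒m%n≡m t<k)

  residueCount-multiple : ∀ s a t → s < k → t ≤ k → residueCount s id (k * a + t) ≡ a + 𝟙[ s < t ]
  residueCount-multiple s zero t s<k t≤k = trans (cong (residueCount s id) (cong (_+ t) (*-zeroʳ k))) (residueCount-≤ s t t≤k)
  residueCount-multiple s (suc a) t s<k t≤k = begin
    residueCount s id (k * suc a + t)
      ≡⟨ cong (residueCount s id) (trans (cong (_+ t) (*-suc k a)) (+-assoc k (k * a) t)) ⟩
    residueCount s id (k + (k * a + t))
      ≡⟨ residueCount-+ s id k (k * a + t) ⟩
    residueCount s id k + residueCount s (_+_ k) (k * a + t)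
      ≡⟨ cong₂ _+_ (trans (residueCount-≤ s k ≤-refl) (𝟙<-yes s<k)) (residueCount-cong s (_+_ k) id (k * a + t) period) ⟩
    1 + residueCount s id (k * a + t)
      ≡⟨ cong suc (residueCount-multiple s a t s<k t≤k) ⟩
    suc a + 𝟙[ s < t ] ∎
    where
    open ≡-Reasoning
    period : ∀ i → (k + i) % k ≡ i % k
    period i = trans (cong (_% k) (+-comm k i)) ([m+n]%n≡m%n i k)

  easts-interleave : ∀ w a t → t ≤ k → easts w (k * a + t) ≡ ∑[ s < k ] easts (subword k s w) (a + 𝟙[ s < t ])
  easts-interleave w a t t≤k = trans (easts-subwords id w (k * a + t))
    (∑-cong k (λ s s<k → cong (easts (subwordAt id s w)) (residueCount-multiple s a t s<k t≤k)))

norths-subwords : ∀ k .{{_ : NonZero k}} w → ∑[ s < k ] norths (subword k s w) ≡ norths w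
norths-subwords k w = +-cancelˡ-≡ (∑[ s < k ] easts (Ws s) (a + 0)) _ _ (begin
  ∑[ s < k ] easts (Ws s) (a + 0) + ∑[ s < k ] norths (Ws s) ≡⟨ sym (∑-+ _ _ k) ⟩
  ∑[ s < k ] (easts (Ws s) (a + 0) + norths (Ws s))           ≡⟨ ∑-cong k (λ s _ → easts+norths (Ws s) (a + 0) (short s)) ⟩
  ∑[ s < k ] (a + 0)                                          ≡⟨ ∑-const (a + 0) k ⟩
  k * (a + 0)                                                 ≡⟨ sym (+-identityʳ _) ⟩
  k * (a + 0) + 0                                             ≡⟨ cong (λ z → k * z + 0) (+-identityʳ a) ⟩
  k * a + 0                                                   ≡⟨ sym (easts+norths w (k * a + 0) (≤-trans (m≤n*m a k) (m≤m+n (k * a) 0))) ⟩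
  easts w (k * a + 0) + norths w                              ≡⟨ cong (_+ norths w) (easts-interleave w a 0 z≤n) ⟩
  ∑[ s < k ] easts (Ws s) (a + 𝟙[ s < 0 ]) + norths w         ∎)
  where
  open ≡-Reasoning
  open Subwords k using (easts-interleave; length-subword)
  a = length w
  Ws = λ s → subword k s w
  short : ∀ s → length (Ws s) ≤ a + 0
  short s = ≤-trans (length-subword s w) (m≤m+n a 0)

[m*k]/ℕk≡m : ∀ m k .{{_ : NonZero k}} → (m ℤ.* + k) /ℕ k ≡ m
[m*k]/ℕk≡m (+ j) k = trans (cong (_/ℕ k) (sym (ℤₚ.pos-* j k))) (cong +_ (m*n/n≡m j k))

-- For negative numerators _/ℕ_ branches on the remainder, which vanishes here.
[m*k]/ℕk≡m -[1+ j ] (suc k′) with suc (k′ + j * suc k′) % suc k′ in rem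
... | zero = cong (λ z → ℤ.- (+ z)) (m*n/n≡m (suc j) (suc k′))
... | suc _ with () ← trans (sym rem) (m*n%n≡0 (suc j) (suc k′))

count-divide : ∀ k .{{_ : NonZero k}} r xs q →
  count q (map (λ x → (x ℤ.+ + r) /ℕ k) (filter (λ x → + k ∣? (x ℤ.+ + r)) xs)) ≡ count (q ℤ.* + k ℤ.- + r) xs
count-divide k r [] q = refl
count-divide k r (y ∷ xs) q with + k ∣? (y ℤ.+ + r)
... | yes k∣y+r@(divides m y+r≡mk) =
  trans (cong (count q ∘ map (λ x → (x ℤ.+ + r) /ℕ k)) (List.filter-accept (λ x → + k ∣? (x ℤ.+ + r)) k∣y+r))
        (cong₂ _+_ (δ-cong to from) (count-divide k r xs q))
  where
  quotient≡m : (y ℤ.+ + r) /ℕ k ≡ m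
  quotient≡m = trans (cong (_/ℕ k) y+r≡mk) ([m*k]/ℕk≡m m k)
  to : q ≡ (y ℤ.+ + r) /ℕ k → q ℤ.* + k ℤ.- + r ≡ y
  to q≡ = trans (cong (λ z → z ℤ.* + k ℤ.- + r) (trans q≡ quotient≡m))
                (trans (cong (ℤ._- + r) (sym y+r≡mk)) ([x+c]-c≡x y (+ r)))
  from : q ℤ.* + k ℤ.- + r ≡ y → q ≡ (y ℤ.+ + r) /ℕ k
  from q≡ = trans (sym ([m*k]/ℕk≡m q k))
                  (cong (_/ℕ k) (trans (sym ([x-c]+c≡x (q ℤ.* + k) (+ r))) (cong (ℤ._+ + r) q≡)))
... | no k∤y+r =
  trans (cong (count q ∘ map (λ x → (x ℤ.+ + r) /ℕ k)) (List.filter-reject (λ x → + k ∣? (x ℤ.+ + r)) k∤y+r))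
        (trans (count-divide k r xs q)
               (cong (_+ count (q ℤ.* + k ℤ.- + r) xs) (sym (δ-≢ λ q*k-r≡y → k∤y+r (divides q (y+r≡qk q*k-r≡y))))))
  where
  y+r≡qk : q ℤ.* + k ℤ.- + r ≡ y → y ℤ.+ + r ≡ q ℤ.* + k
  y+r≡qk e = trans (cong (ℤ._+ + r) (sym e)) ([x-c]+c≡x (q ℤ.* + k) (+ r))

count-concatMap : ∀ q (F : ℕ → List ℤ) n → count q (concatMap F (upTo n)) ≡ ∑[ i < n ] count q (F i)
count-concatMap q F zero = refl
count-concatMap q F (suc n) = begin
  count q (concat (map F (upTo (suc n))))              ≡⟨ cong (count q ∘ concat ∘ map F) (sym (List.upTo-∷ʳ n)) ⟩
  count q (concat (map F (upTo n ++ [ n ])))           ≡⟨ cong (count q ∘ concat) (List.map-++ F (upTo n) [ n ]) ⟩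
  count q (concat (map F (upTo n) ++ [ F n ]))         ≡⟨ cong (count q) (sym (List.concat-++ (map F (upTo n)) [ F n ])) ⟩
  count q (concat (map F (upTo n)) ++ (F n ++ []))     ≡⟨ count-++ q (concat (map F (upTo n))) _ ⟩
  count q (concatMap F (upTo n)) + count q (F n ++ []) ≡⟨ cong₂ _+_ (count-concatMap q F n) (cong (count q) (List.++-identityʳ (F n))) ⟩
  ∑[ i < n ] count q (F i) + count q (F n)            ∎
  where open ≡-Reasoning

quotientCount : (k : ℕ) → .{{_ : NonZero k}} → List ℕ → ℕ → ℤ → ℕ
quotientCount k λ′ i x = count x (contents (quotient k λ′ i))

count-rhs : ∀ k .{{_ : NonZero k}} r λ′ q →
  count q (rhs k r λ′) ≡ ∑[ i < k ] quotientCount k λ′ i (if i <ᵇ k ∸ r then q else q ℤ.- ℤ.1ℤ)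
count-rhs k r λ′ q = trans (count-concatMap q _ k) (∑-cong k (λ i _ → by-cases (i <ᵇ k ∸ r)))
  where
  by-cases : ∀ {i} b → count q (if b then contents (quotient k λ′ i) else map (ℤ._+ ℤ.1ℤ) (contents (quotient k λ′ i)))
                       ≡ quotientCount k λ′ i (if b then q else q ℤ.- ℤ.1ℤ)
  by-cases true = refl
  by-cases {i} false = count-map-+ ℤ.1ℤ q (contents (quotient k λ′ i))

-- The identity for a balanced boundary word

easts-interleave-vanishing : ∀ k .{{_ : NonZero k}} r w y → (y ℤ.* + k ℤ.- + r) ⁺ ≡ 0 → y ⁺ ≡ 0 → (y ℤ.- ℤ.1ℤ) ⁺ ≡ 0 →
  easts w ((y ℤ.* + k ℤ.- + r) ⁺) ≡ ∑[ s < k ] easts (subword k s w) ((if s <ᵇ k ∸ r then y else y ℤ.- ℤ.1ℤ) ⁺)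
easts-interleave-vanishing k r w y lhs≡0 y≡0 y-1≡0 = begin
  easts w ((y ℤ.* + k ℤ.- + r) ⁺) ≡⟨ trans (cong (easts w) lhs≡0) (easts-zero w) ⟩
  0                               ≡⟨ sym (∑-zero k) ⟩
  ∑[ s < k ] 0                    ≡⟨ ∑-cong k (λ s _ → sym (trans (cong (easts (subword k s w)) (either s)) (easts-zero (subword k s w)))) ⟩
  ∑[ s < k ] easts (subword k s w) ((if s <ᵇ k ∸ r then y else y ℤ.- ℤ.1ℤ) ⁺) ∎
  where
  open ≡-Reasoning
  either : ∀ s → (if s <ᵇ k ∸ r then y else y ℤ.- ℤ.1ℤ) ⁺ ≡ 0
  either s with s <ᵇ k ∸ r
  ... | true = y≡0
  ... | false = y-1≡0

easts-interleave-ℤ : ∀ k .{{_ : NonZero k}} r → r < k → ∀ w y →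
  easts w ((y ℤ.* + k ℤ.- + r) ⁺) ≡ ∑[ s < k ] easts (subword k s w) ((if s <ᵇ k ∸ r then y else y ℤ.- ℤ.1ℤ) ⁺)
easts-interleave-ℤ k r r<k w (+ suc a) = begin
  easts w ((+ suc a ℤ.* + k ℤ.- + r) ⁺)                  ≡⟨ cong (easts w) position ⟩
  easts w (k * a + (k ∸ r))                              ≡⟨ easts-interleave w a (k ∸ r) (m∸n≤m k r) ⟩
  ∑[ s < k ] easts (subword k s w) (a + 𝟙[ s < k ∸ r ]) ≡⟨ ∑-cong k (λ s _ → cong (easts (subword k s w)) (per-subword s)) ⟩
  ∑[ s < k ] easts (subword k s w) ((if s <ᵇ k ∸ r then + suc a else + suc a ℤ.- ℤ.1ℤ) ⁺) ∎
  where
  open ≡-Reasoning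
  open Subwords k using (easts-interleave)
  position : (+ suc a ℤ.* + k ℤ.- + r) ⁺ ≡ k * a + (k ∸ r)
  position = begin
    (+ suc a ℤ.* + k ℤ.- + r) ⁺  ≡⟨ cong (λ z → (z ℤ.- + r) ⁺) (sym (ℤₚ.pos-* (suc a) k)) ⟩
    (+ (suc a * k) ℤ.- + r) ⁺    ≡⟨ cong _⁺ (+m-+n≡+[m∸n] (≤-trans (<⇒≤ r<k) (m≤m+n k (a * k)))) ⟩
    k + a * k ∸ r                ≡⟨ +-∸-comm (a * k) (<⇒≤ r<k) ⟩
    k ∸ r + a * k                ≡⟨ trans (+-comm (k ∸ r) (a * k)) (cong (_+ (k ∸ r)) (*-comm a k)) ⟩
    k * a + (k ∸ r)              ∎
  per-subword : ∀ s → a + 𝟙[ s < k ∸ r ] ≡ (if s <ᵇ k ∸ r then + suc a else + suc a ℤ.- ℤ.1ℤ) ⁺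
  per-subword s rewrite 𝟙<≡if s (k ∸ r) with s <ᵇ k ∸ r
  ... | true = +-comm a 1
  ... | false = +-identityʳ a
easts-interleave-ℤ k r r<k w (+ zero) = easts-interleave-vanishing k r w (+ 0) (vanish r) refl refl
  where
  vanish : ∀ r → (+ 0 ℤ.* + k ℤ.- + r) ⁺ ≡ 0
  vanish zero = refl
  vanish (suc r) = refl
easts-interleave-ℤ (suc k) r r<k w -[1+ n ] = easts-interleave-vanishing (suc k) r w -[1+ n ] (vanish r) refl refl
  where
  vanish : ∀ r → (-[1+ n ] ℤ.* + suc k ℤ.- + r) ⁺ ≡ 0
  vanish zero = refl
  vanish (suc r) = refl

Balanced : (k : ℕ) → .{{NonZero k}} → List Bool → ℕ → Set
Balanced k w L = ∀ s → s < k → norths (subword k s w) ≡ L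

padded-length : ∀ k .{{_ : NonZero k}} λ′ → ∃[ L ] length (padZeros k λ′) ≡ k * L
padded-length k λ′ with length λ′ % k in rem
... | zero = length λ′ / k , (begin
  length (λ′ ++ replicate ((k ∸ 0) % k) 0)       ≡⟨ List.length-++ λ′ ⟩
  length λ′ + length (replicate ((k ∸ 0) % k) 0) ≡⟨ cong (_+_ (length λ′)) (trans (List.length-replicate ((k ∸ 0) % k)) (n%n≡0 k)) ⟩
  length λ′ + 0                                  ≡⟨ +-identityʳ _ ⟩
  length λ′                                      ≡⟨ m≡m%n+[m/n]*n (length λ′) k ⟩
  length λ′ % k + length λ′ / k * k              ≡⟨ cong (_+ length λ′ / k * k) rem ⟩
  length λ′ / k * k                              ≡⟨ *-comm (length λ′ / k) k ⟩
  k * (length λ′ / k)                            ∎)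
  where open ≡-Reasoning
... | suc r = suc (length λ′ / k) , (begin
  length (λ′ ++ replicate ((k ∸ suc r) % k) 0)      ≡⟨ List.length-++ λ′ ⟩
  length λ′ + length (replicate ((k ∸ suc r) % k) 0) ≡⟨ cong (_+_ (length λ′)) (trans (List.length-replicate ((k ∸ suc r) % k)) pad≡) ⟩
  length λ′ + (k ∸ suc r)                            ≡⟨ cong (_+ (k ∸ suc r)) (trans (m≡m%n+[m/n]*n (length λ′) k) (cong (_+ q * k) rem)) ⟩
  suc r + q * k + (k ∸ suc r)                        ≡⟨ xy∙z≈y∙xz (suc r) (q * k) (k ∸ suc r) ⟩
  q * k + (suc r + (k ∸ suc r))                      ≡⟨ cong (_+_ (q * k)) (m+[n∸m]≡n r<k) ⟩
  q * k + k                                          ≡⟨ ring q k ⟩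
  k * suc q                                          ∎)
  where
  open ≡-Reasoning
  q = length λ′ / k
  r<k : suc r ≤ k
  r<k = <⇒≤ (subst (_< k) rem (m%n<n (length λ′) k))
  pad≡ : (k ∸ suc r) % k ≡ k ∸ suc r
  pad≡ = m<n⇒m%n≡m (∸-monoʳ-< {k} {suc r} {0} (s≤s z≤n) r<k)
  ring : ∀ q k → q * k + k ≡ k * suc q
  ring = ℕ-Solver.solve-∀

module Padded (k : ℕ) .{{_ : NonZero k}} (λ′ : List ℕ) (dec : Decreasing λ′) (L : ℕ)
              (rows : length (padZeros k λ′) ≡ k * L) where

  W : List Bool
  W = boundaryWord (padZeros k λ′)

  count-contents-padded : ∀ x → count x (contents λ′) + x ⁺ ≡ easts W ((x ℤ.+ + (k * L)) ⁺)
  count-contents-padded x = begin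
    count x (contents λ′) + x ⁺
      ≡⟨ cong (_+ x ⁺) (count-contents-cong λ′ (padZeros k λ′) (λ a → sym (part-++-replicate-0 λ′ _ a)) x) ⟩
    count x (contents (padZeros k λ′)) + x ⁺
      ≡⟨ count-contents-boundaryWord (padZeros k λ′) (decreasing-padded λ′ _ dec) x ⟩
    easts W ((x ℤ.+ + length (padZeros k λ′)) ⁺)
      ≡⟨ cong (λ n → easts W ((x ℤ.+ + n) ⁺)) rows ⟩
    easts W ((x ℤ.+ + (k * L)) ⁺) ∎
    where open ≡-Reasoning

  quotientCount-balanced : Balanced k W L → ∀ i → i < k → ∀ x →
    quotientCount k λ′ i x + x ⁺ ≡ easts (subword k i W) ((x ℤ.+ + L) ⁺)
  quotientCount-balanced balanced i i<k x =
    trans (count-contents-fromWord (subword k i W) x) (cong (λ n → easts (subword k i W) ((x ℤ.+ + n) ⁺)) (balanced i i<k))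

  -- Both sides, shifted by x ⁺, are read off W: directly on the left, through the subwords on the right.
  count-contents-class : Balanced k W L → ∀ r → r < k → ∀ q →
    count (q ℤ.* + k ℤ.- + r) (contents λ′) ≡ ∑[ s < k ] quotientCount k λ′ s (if s <ᵇ k ∸ r then q else q ℤ.- ℤ.1ℤ)
  count-contents-class balanced r r<k q = +-cancelʳ-≡ (x ⁺) _ _ (begin
    count x (contents λ′) + x ⁺
      ≡⟨ count-contents-padded x ⟩
    easts W ((x ℤ.+ + (k * L)) ⁺)
      ≡⟨ cong (λ z → easts W ((x ℤ.+ z) ⁺)) (ℤₚ.pos-* k L) ⟩
    easts W ((x ℤ.+ + k ℤ.* + L) ⁺)
      ≡⟨ cong (λ z → easts W (z ⁺)) (offset q (+ k) (+ r) (+ L)) ⟩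
    easts W (((q ℤ.+ + L) ℤ.* + k ℤ.- + r) ⁺)
      ≡⟨ easts-interleave-ℤ k r r<k W (q ℤ.+ + L) ⟩
    ∑[ s < k ] easts (subword k s W) ((if s <ᵇ k ∸ r then q ℤ.+ + L else q ℤ.+ + L ℤ.- ℤ.1ℤ) ⁺)
      ≡⟨ ∑-cong k per-subword ⟩
    ∑[ s < k ] (quotientCount k λ′ s (q′ s) + q′ s ⁺)
      ≡⟨ ∑-+ _ _ k ⟩
    Q + ∑[ s < k ] (q′ s ⁺)
      ≡⟨ cong (_+_ Q) (sym (easts-interleave-ℤ k r r<k [] q)) ⟩
    Q + x ⁺ ∎)
    where
    open ≡-Reasoning
    x = q ℤ.* + k ℤ.- + r
    q′ : ℕ → ℤ
    q′ s = if s <ᵇ k ∸ r then q else q ℤ.- ℤ.1ℤ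
    Q = ∑[ s < k ] quotientCount k λ′ s (q′ s)
    offset : ∀ (q k r l : ℤ) → (q ℤ.* k ℤ.- r) ℤ.+ k ℤ.* l ≡ (q ℤ.+ l) ℤ.* k ℤ.- r
    offset = solve-∀
    add-rows : ∀ s → (if s <ᵇ k ∸ r then q ℤ.+ + L else q ℤ.+ + L ℤ.- ℤ.1ℤ) ≡ q′ s ℤ.+ + L
    add-rows s with s <ᵇ k ∸ r
    ... | true = refl
    ... | false = ring q (+ L)
      where
      ring : ∀ (q l : ℤ) → q ℤ.+ l ℤ.- ℤ.1ℤ ≡ (q ℤ.- ℤ.1ℤ) ℤ.+ l
      ring = solve-∀
    per-subword : ∀ s → s < k →
      easts (subword k s W) ((if s <ᵇ k ∸ r then q ℤ.+ + L else q ℤ.+ + L ℤ.- ℤ.1ℤ) ⁺) ≡ quotientCount k λ′ s (q′ s) + q′ s ⁺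
    per-subword s s<k =
      trans (cong (λ z → easts (subword k s W) (z ⁺)) (add-rows s)) (sym (quotientCount-balanced balanced s s<k (q′ s)))

  count-lhs≡count-rhs : Balanced k W L → ∀ r → r < k → ∀ q → count q (lhs k r λ′) ≡ count q (rhs k r λ′)
  count-lhs≡count-rhs balanced r r<k q = begin
    count q (lhs k r λ′)                     ≡⟨ count-divide k r (contents λ′) q ⟩
    count (q ℤ.* + k ℤ.- + r) (contents λ′) ≡⟨ count-contents-class balanced r r<k q ⟩
    ∑[ s < k ] quotientCount k λ′ s (if s <ᵇ k ∸ r then q else q ℤ.- ℤ.1ℤ) ≡⟨ sym (count-rhs k r λ′ q) ⟩
    count q (rhs k r λ′)                     ∎
    where open ≡-Reasoning

-- Border strips

part-suc≤ : ∀ {μ} → Decreasing μ → ∀ i → part μ (suc i) ≤ part μ i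
part-suc≤ dnil i = z≤n
part-suc≤ (dsing a) zero = z≤n
part-suc≤ (dsing a) (suc i) = z≤n
part-suc≤ (dcons b≤a dec) zero = b≤a
part-suc≤ (dcons b≤a dec) (suc i) = part-suc≤ dec i

part-antitone : ∀ {μ} → Decreasing μ → ∀ {i j} → i ≤ j → part μ j ≤ part μ i
part-antitone {μ} dec {i} {j} i≤j = subst (λ j → part μ j ≤ part μ i) (m+[n∸m]≡n i≤j) (down (j ∸ i))
  where
  down : ∀ m → part μ (i + m) ≤ part μ i
  down zero = ≤-reflexive (cong (part μ) (+-identityʳ i))
  down (suc m) = ≤-trans (≤-reflexive (cong (part μ) (+-suc i m))) (≤-trans (part-suc≤ dec (i + m)) (down m))

part>0⇒<length : ∀ μ a → 0 < part μ a → a < length μ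
part>0⇒<length (p ∷ μ) zero _ = s≤s z≤n
part>0⇒<length (p ∷ μ) (suc a) pos = s≤s (part>0⇒<length μ a pos)

part-positive : ∀ {μ} → AllPos μ → ∀ a → a < length μ → 0 < part μ a
part-positive (pcons pos _) zero _ = pos
part-positive (pcons _ all) (suc a) (s≤s a<len) = part-positive all a a<len

part≤size : ∀ μ a → part μ a ≤ size μ
part≤size [] a = z≤n
part≤size (p ∷ μ) zero = m≤m+n p _
part≤size (p ∷ μ) (suc a) = ≤-trans (part≤size μ a) (m≤n+m _ p)

length≤size : ∀ {μ} → AllPos μ → length μ ≤ size μ
length≤size pnil = z≤n
length≤size (pcons pos all) = +-mono-≤ pos (length≤size all)

parts≤size : ∀ μ → All (_≤ size μ) μ
parts≤size [] = []
parts≤size (p ∷ μ) = m≤m+n p (size μ) ∷ All.map (λ q≤ → ≤-trans q≤ (m≤n+m (size μ) p)) (parts≤size μ)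

size≡∑part : ∀ μ → size μ ≡ ∑< (length μ) (part μ)
size≡∑part [] = refl
size≡∑part (p ∷ μ) = trans (cong (_+_ p) (size≡∑part μ)) (sym (∑-split (part (p ∷ μ)) 1 (length μ)))

content : Cell → ℤ
content (a , b) = + b ℤ.- + a

column-step : ∀ (b a : ℤ) → (ℤ.1ℤ ℤ.+ b) ℤ.- a ≡ ℤ.1ℤ ℤ.+ (b ℤ.- a)
column-step = solve-∀

row-step : ∀ (b a : ℤ) → b ℤ.- a ≡ ℤ.1ℤ ℤ.+ (b ℤ.- (ℤ.1ℤ ℤ.+ a))
row-step = solve-∀

adjacent-content : ∀ {c d} → Adjacent c d → content d ≡ ℤ.suc (content c) ⊎ content c ≡ ℤ.suc (content d)
adjacent-content {a , b} (inj₁ (refl , inj₁ refl)) = inj₁ (column-step (+ b) (+ a))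
adjacent-content {a , _} {_ , b} (inj₁ (refl , inj₂ refl)) = inj₂ (column-step (+ b) (+ a))
adjacent-content {a , b} (inj₂ (refl , inj₁ refl)) = inj₂ (row-step (+ b) (+ a))
adjacent-content {_ , b} {a , _} (inj₂ (refl , inj₂ refl)) = inj₁ (row-step (+ b) (+ a))

adjacent-content≤suc : ∀ {c d} → Adjacent c d → content d ℤ.≤ ℤ.suc (content c)
adjacent-content≤suc adj with adjacent-content adj
... | inj₁ up = ℤₚ.≤-reflexive up
... | inj₂ down = ℤₚ.≤-trans (ℤₚ.i≤suc[i] _) (ℤₚ.≤-trans (ℤₚ.≤-reflexive (sym down)) (ℤₚ.i≤suc[i] _))

-- A path cannot skip a content, since each step raises the content by at most one.
path-content : ∀ {S : Cell → Set} {c e} → Path S c e → ∀ y → content c ℤ.≤ y → y ℤ.≤ content e →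
  ∃[ d ] S d × content d ≡ y
path-content {c = c} (stop Sc) y c≤y y≤e = c , Sc , ℤₚ.≤-antisym c≤y y≤e
path-content {c = c} (step Sc adj path) y c≤y y≤e with content c ℤ.≟ y
... | yes c≡y = c , Sc , c≡y
... | no c≢y = path-content path y (ℤₚ.≤-trans (adjacent-content≤suc adj) (ℤₚ.i<j⇒suc[i]≤j (ℤₚ.≤∧≢⇒< c≤y c≢y)))
                                   y≤e

module BorderStrip (λ′ μ : List ℕ) (dλ : Decreasing λ′) (dμ : Decreasing μ) (pμ : AllPos μ) (μ⊆λ : μ ⊆λ λ′)
                   (connected : Connected (SkewCell λ′ μ)) (thin : No2x2 (SkewCell λ′ μ)) where

  part-⊆ : ∀ a → part μ a ≤ part λ′ a
  part-⊆ a with part μ a in eq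
  ... | zero = z≤n
  ... | suc b = μ⊆λ (a , b) (subst (b <_) (sym eq) ≤-refl)

  length-⊆ : length μ ≤ length λ′
  length-⊆ with length μ in eq
  ... | zero = z≤n
  ... | suc n = part>0⇒<length λ′ n (<-≤-trans (part-positive pμ n (subst (n <_) (sym eq) ≤-refl)) (part-⊆ n))

  stripRow : ℕ → ℤ → ℕ
  stripRow a x = 𝟙[0≤ x ℤ.+ + a < part λ′ a ] ∸ 𝟙[0≤ x ℤ.+ + a < part μ a ]

  -- the number of cells of λ′/μ of content x
  stripCount : ℤ → ℕ
  stripCount x = ∑[ a < length λ′ ] stripRow a x

  count-contents-strip : ∀ x → count x (contents λ′) ≡ count x (contents μ) + stripCount x
  count-contents-strip x = begin
    count x (contents λ′)                     ≡⟨ count-contents λ′ x ⟩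
    ∑< (length λ′) inλ                        ≡⟨ ∑-cong (length λ′) (λ a _ → sym (m+[n∸m]≡n (𝟙[0≤<]-mono (x ℤ.+ + a) (part-⊆ a)))) ⟩
    ∑[ a < length λ′ ] (inμ a + stripRow a x) ≡⟨ ∑-+ inμ (λ a → stripRow a x) (length λ′) ⟩
    ∑< (length λ′) inμ + stripCount x         ≡⟨ cong (_+ stripCount x) (sym (count-contents-≤ μ x length-⊆)) ⟩
    count x (contents μ) + stripCount x       ∎
    where
    open ≡-Reasoning
    inλ = λ a → 𝟙[0≤ x ℤ.+ + a < part λ′ a ]
    inμ = λ a → 𝟙[0≤ x ℤ.+ + a < part μ a ]

  stripRow≤1 : ∀ a x → stripRow a x ≤ 1
  stripRow≤1 a x = ≤-trans (m∸n≤m _ 𝟙[0≤ x ℤ.+ + a < part μ a ]) (𝟙[0≤<]≤1 (x ℤ.+ + a) (part λ′ a))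

  stripRow>0⇒cell : ∀ a x → 0 < stripRow a x → ∃[ b ] x ℤ.+ + a ≡ + b × SkewCell λ′ μ (a , b)
  stripRow>0⇒cell a x pos with x ℤ.+ + a
  ... | + b with b <? part λ′ a | b <? part μ a
  ...   | yes inλ | no ∉μ = b , refl , inλ , ∉μ
  ...   | no ∉λ | _ = ⊥-elim (<-irrefl refl (≤-trans pos (≤-trans (m∸n≤m _ 𝟙[ b < part μ a ]) (≤-reflexive (𝟙<-no (≮⇒≥ ∉λ))))))
  ...   | yes inλ | yes inμ = ⊥-elim (<-irrefl refl (≤-trans pos (≤-reflexive (cong₂ _∸_ (𝟙<-yes inλ) (𝟙<-yes inμ)))))

  cell⇒stripRow≡1 : ∀ a b → SkewCell λ′ μ (a , b) → stripRow a (content (a , b)) ≡ 1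
  cell⇒stripRow≡1 a b (inλ , ∉μ) =
    trans (cong (λ z → 𝟙[0≤ z < part λ′ a ] ∸ 𝟙[0≤ z < part μ a ]) ([x-c]+c≡x (+ b) (+ a)))
          (cong₂ _∸_ (𝟙<-yes inλ) (𝟙<-no (≮⇒≥ ∉μ)))

  stripCount>0⇒cell : ∀ x → 0 < stripCount x → ∃[ c ] SkewCell λ′ μ c × content c ≡ x
  stripCount>0⇒cell x pos with ∑>0⇒∃ (λ a → stripRow a x) (length λ′) pos
  ... | a , _ , row>0 with stripRow>0⇒cell a x row>0
  ...   | b , x+a≡b , cell = (a , b) , cell , trans (cong (ℤ._- + a) (sym x+a≡b)) ([x+c]-c≡x x (+ a))

  cell⇒stripCount>0 : ∀ c → SkewCell λ′ μ c → 0 < stripCount (content c)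
  cell⇒stripCount>0 (a , b) cell@(inλ , _) =
    ≤-trans (≤-reflexive (sym (cell⇒stripRow≡1 a b cell)))
            (term≤∑ (λ a′ → stripRow a′ (content (a , b))) (part>0⇒<length λ′ a (≤-<-trans z≤n inλ)))

  -- Two cells of equal content in rows a < a′ span a 2×2 square.
  stripCount≤1 : ∀ x → stripCount x ≤ 1
  stripCount≤1 x with 2 ≤? stripCount x
  ... | no ≱2 = ≤-pred (≰⇒> ≱2)
  ... | yes ≥2 with ∑>1⇒∃₂ (λ a → stripRow a x) (length λ′) (λ a _ → stripRow≤1 a x) ≥2
  ...   | a , a′ , a<a′ , _ , row , row′ with stripRow>0⇒cell a x row | stripRow>0⇒cell a′ x row′
  ...     | b , x+a≡b , (inλ , ∉μ) | b′ , x+a′≡b′ , (inλ′ , _) =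
    ⊥-elim (thin (a , b , (inλ , ∉μ) , right , below , diagonal))
    where
    swap : ∀ (x a a′ : ℤ) → (x ℤ.+ a) ℤ.+ a′ ≡ (x ℤ.+ a′) ℤ.+ a
    swap = solve-∀
    same-content : b + a′ ≡ b′ + a
    same-content = ℤₚ.+-injective (begin
      + (b + a′)              ≡⟨ ℤₚ.pos-+ b a′ ⟩
      + b ℤ.+ + a′            ≡⟨ cong (ℤ._+ + a′) (sym x+a≡b) ⟩
      (x ℤ.+ + a) ℤ.+ + a′    ≡⟨ swap x (+ a) (+ a′) ⟩
      (x ℤ.+ + a′) ℤ.+ + a    ≡⟨ cong (ℤ._+ + a) x+a′≡b′ ⟩
      + b′ ℤ.+ + a            ≡⟨ sym (ℤₚ.pos-+ b′ a) ⟩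
      + (b′ + a)              ∎)
      where open ≡-Reasoning
    b<b′ : b < b′
    b<b′ = +-cancelʳ-< a b b′ (<-≤-trans (+-monoʳ-< b a<a′) (≤-reflexive same-content))
    corner : suc b < part λ′ (suc a)
    corner = <-≤-trans (≤-<-trans b<b′ inλ′) (part-antitone dλ a<a′)
    right : SkewCell λ′ μ (a , suc b)
    right = <-≤-trans corner (part-suc≤ dλ a) , (λ inμ → ∉μ (<-trans (n<1+n b) inμ))
    below : SkewCell λ′ μ (suc a , b)
    below = <-trans (n<1+n b) corner , (λ inμ → ∉μ (<-≤-trans inμ (part-suc≤ dμ a)))
    diagonal : SkewCell λ′ μ (suc a , suc b)
    diagonal = corner , (λ inμ → ∉μ (<-≤-trans (<-trans (n<1+n b) inμ) (part-suc≤ dμ a)))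

  stripCount-interval : ∀ x₁ x₂ y → 0 < stripCount x₁ → 0 < stripCount x₂ → x₁ ℤ.≤ y → y ℤ.≤ x₂ →
    0 < stripCount y
  stripCount-interval x₁ x₂ y pos₁ pos₂ x₁≤y y≤x₂ with stripCount>0⇒cell x₁ pos₁ | stripCount>0⇒cell x₂ pos₂
  ... | c₁ , cell₁ , refl | c₂ , cell₂ , refl with path-content (connected c₁ c₂ cell₁ cell₂) y x₁≤y y≤x₂
  ...   | d , cell , refl = cell⇒stripCount>0 d cell

-- Empty k-core ⇒ balanced boundary word

∑-𝟙[0≤<]-window : ∀ c p n → c + p ≤ n → ∑[ j < n ] 𝟙[0≤ + j ℤ.- + c < p ] ≡ p
∑-𝟙[0≤<]-window c p n c+p≤n = begin
  ∑[ j < n ] 𝟙[0≤ + j ℤ.- + c < p ]           ≡⟨ cong (λ m → ∑[ j < m ] 𝟙[0≤ + j ℤ.- + c < p ]) (sym (m+[n∸m]≡n c≤n)) ⟩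
  ∑[ j < c + (n ∸ c) ] 𝟙[0≤ + j ℤ.- + c < p ] ≡⟨ ∑-zero-prefix _ c (n ∸ c) below ⟩
  ∑[ i < n ∸ c ] 𝟙[0≤ + (c + i) ℤ.- + c < p ] ≡⟨ ∑-cong (n ∸ c) (λ i _ → cong 𝟙[0≤_< p ] (above i)) ⟩
  ∑[ i < n ∸ c ] 𝟙[ i < p ]                   ≡⟨ ∑-𝟙< p (n ∸ c) (≤-trans (≤-reflexive (sym (m+n∸m≡n c p))) (∸-monoˡ-≤ c c+p≤n)) ⟩
  p                                           ∎
  where
  open ≡-Reasoning
  c≤n = ≤-trans (m≤m+n c p) c+p≤n
  below : ∀ j → j < c → 𝟙[0≤ + j ℤ.- + c < p ] ≡ 0
  below j j<c with +m-+n<0 j<c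
  ... | d , eq = cong 𝟙[0≤_< p ] eq
  above : ∀ i → + (c + i) ℤ.- + c ≡ + i
  above i = trans (+m-+n≡+[m∸n] (m≤m+n c i)) (cong +_ (m+n∸m≡n c i))

-- If the contents of μ lie in [-B, n - B), the window counts every cell once.
∑-count-contents-window : ∀ μ B n → length μ ≤ B → (∀ a → a < length μ → (B ∸ a) + part μ a ≤ n) →
  ∑[ j < n ] count (+ j ℤ.- + B) (contents μ) ≡ size μ
∑-count-contents-window μ B n len≤B inside = begin
  ∑[ j < n ] count (+ j ℤ.- + B) (contents μ)       ≡⟨ ∑-cong n (λ j _ → count-contents μ (+ j ℤ.- + B)) ⟩
  ∑[ j < n ] ∑[ a < length μ ] cell j a             ≡⟨ ∑-swap cell n (length μ) ⟩
  ∑[ a < length μ ] ∑[ j < n ] cell j a             ≡⟨ ∑-cong (length μ) row ⟩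
  ∑< (length μ) (part μ)                            ≡⟨ sym (size≡∑part μ) ⟩
  size μ                                            ∎
  where
  open ≡-Reasoning
  cell : ℕ → ℕ → ℕ
  cell j a = 𝟙[0≤ (+ j ℤ.- + B) ℤ.+ + a < part μ a ]
  reassoc : ∀ (j b a : ℤ) → (j ℤ.- b) ℤ.+ a ≡ j ℤ.- (b ℤ.- a)
  reassoc = solve-∀
  row : ∀ a → a < length μ → ∑[ j < n ] cell j a ≡ part μ a
  row a a<len = trans (∑-cong n (λ j _ → cong 𝟙[0≤_< part μ a ] (row-offset j))) (∑-𝟙[0≤<]-window (B ∸ a) (part μ a) n (inside a a<len))
    where
    row-offset : ∀ j → (+ j ℤ.- + B) ℤ.+ + a ≡ + j ℤ.- + (B ∸ a)
    row-offset j = trans (reassoc (+ j) (+ B) (+ a)) (cong (ℤ._-_ (+ j)) (+m-+n≡+[m∸n] (≤-trans (<⇒≤ a<len) len≤B)))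

k*i+t<k*j : ∀ k {i j t} → t < k → i < j → k * i + t < k * j
k*i+t<k*j k {i} t<k i<j =
  <-≤-trans (+-monoʳ-< (k * i) t<k) (≤-trans (≤-reflexive (trans (+-comm (k * i) k) (sym (*-suc k i)))) (*-monoʳ-≤ k i<j))

-- The contents at j = j − k S, j < k A, cover every partition of size ≤ S; the class of t (mod k) is sampled at j = k i + t.
module Window (k : ℕ) .{{_ : NonZero k}} (S : ℕ) where

  A : ℕ
  A = k * S + 2 * S + 1

  at : ℕ → ℤ
  at j = + j ℤ.- + (k * S)

  at-mono : ∀ {j j′} → j ≤ j′ → at j ℤ.≤ at j′
  at-mono j≤j′ = ℤₚ.+-monoˡ-≤ (ℤ.- + (k * S)) (ℤ.+≤+ j≤j′)

  residueWindow : List ℕ → ℕ → ℕ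
  residueWindow μ t = ∑[ i < A ] count (at (k * i + t)) (contents μ)

  ∑-window : ∀ μ → AllPos μ → size μ ≤ S → ∑[ j < k * A ] count (at j) (contents μ) ≡ size μ
  ∑-window μ pos μ≤S = ∑-count-contents-window μ (k * S) (k * A)
    (≤-trans (length≤size pos) (≤-trans μ≤S (m≤n*m S k)))
    (λ a _ → ≤-trans (+-mono-≤ (m∸n≤m (k * S) a) (≤-trans (part≤size μ a) μ≤S)) kS+S≤kA)
    where
    grow : ∀ k S → k * S + S + (S + 1) ≡ k * S + 2 * S + 1
    grow = ℕ-Solver.solve-∀
    kS+S≤kA : k * S + S ≤ k * A
    kS+S≤kA = ≤-trans (m≤m+n (k * S + S) (S + 1)) (≤-trans (≤-reflexive (grow k S)) (m≤n*m A k))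

  ∑-drop-negative : ∀ (g : ℕ → ℕ) → g 0 ≡ 0 → ∀ D M c t → t < k → k * S ≡ k * D + c → A ≡ D + M →
    ∑[ i < A ] g ((at (k * i + t) ℤ.+ + c) ⁺) ≡ ∑[ j < M ] g (k * j + t)
  ∑-drop-negative g g0≡0 D M c t t<k kS≡kD+c A≡D+M = begin
    ∑[ i < A ] g ((at (k * i + t) ℤ.+ + c) ⁺)       ≡⟨ cong (λ n → ∑[ i < n ] g ((at (k * i + t) ℤ.+ + c) ⁺)) A≡D+M ⟩
    ∑[ i < D + M ] g ((at (k * i + t) ℤ.+ + c) ⁺)   ≡⟨ ∑-zero-prefix _ D M negative ⟩
    ∑[ j < M ] g ((at (k * (D + j) + t) ℤ.+ + c) ⁺) ≡⟨ ∑-cong M (λ j _ → cong g (nonnegative j)) ⟩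
    ∑[ j < M ] g (k * j + t)                        ∎
    where
    open ≡-Reasoning
    cancel : ∀ (m n c : ℤ) → m ℤ.- (n ℤ.+ c) ℤ.+ c ≡ m ℤ.- n
    cancel = solve-∀
    split : ∀ k D j t → k * (D + j) + t ≡ k * D + (k * j + t)
    split = ℕ-Solver.solve-∀
    shifted : ∀ m → at m ℤ.+ + c ≡ + m ℤ.- + (k * D)
    shifted m = trans (cong (λ z → + m ℤ.- z ℤ.+ + c) (trans (cong +_ kS≡kD+c) (ℤₚ.pos-+ (k * D) c)))
                      (cancel (+ m) (+ (k * D)) (+ c))
    negative : ∀ i → i < D → g ((at (k * i + t) ℤ.+ + c) ⁺) ≡ 0
    negative i i<D with +m-+n<0 (k*i+t<k*j k t<k i<D)
    ... | d , eq = trans (cong (λ z → g (z ⁺)) (trans (shifted (k * i + t)) eq)) g0≡0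
    nonnegative : ∀ j → (at (k * (D + j) + t) ℤ.+ + c) ⁺ ≡ k * j + t
    nonnegative j = cong _⁺ (begin
      at (k * (D + j) + t) ℤ.+ + c              ≡⟨ shifted (k * (D + j) + t) ⟩
      + (k * (D + j) + t) ℤ.- + (k * D)         ≡⟨ cong (λ m → + m ℤ.- + (k * D)) (split k D j t) ⟩
      + (k * D + (k * j + t)) ℤ.- + (k * D)     ≡⟨ +m-+n≡+[m∸n] (m≤m+n (k * D) _) ⟩
      + (k * D + (k * j + t) ∸ k * D)           ≡⟨ cong +_ (m+n∸m≡n (k * D) _) ⟩
      + (k * j + t)                             ∎)

module StripWindow (k : ℕ) .{{_ : NonZero k}} (S : ℕ) (λ′ μ : List ℕ) (dλ : Decreasing λ′) (pλ : AllPos λ′)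
                   (dμ : Decreasing μ) (pμ : AllPos μ) (μ⊆λ : μ ⊆λ λ′) (sizes : size λ′ ≡ size μ + k)
                   (connected : Connected (SkewCell λ′ μ)) (thin : No2x2 (SkewCell λ′ μ)) (λ≤S : size λ′ ≤ S) where

  open Window k S
  open BorderStrip λ′ μ dλ dμ pμ μ⊆λ connected thin

  ∑-stripCount : ∑[ j < k * A ] stripCount (at j) ≡ k
  ∑-stripCount = +-cancelˡ-≡ (size μ) _ _ (begin
    size μ + T                                                     ≡⟨ cong (_+ T) (sym (∑-window μ pμ μ≤S)) ⟩
    ∑[ j < k * A ] count (at j) (contents μ) + T                   ≡⟨ sym (∑-+ _ _ (k * A)) ⟩
    ∑[ j < k * A ] (count (at j) (contents μ) + stripCount (at j)) ≡⟨ ∑-cong (k * A) (λ j _ → sym (count-contents-strip (at j))) ⟩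
    ∑[ j < k * A ] count (at j) (contents λ′)                      ≡⟨ ∑-window λ′ pλ λ≤S ⟩
    size λ′                                                        ≡⟨ sizes ⟩
    size μ + k                                                     ∎)
    where
    open ≡-Reasoning
    T = ∑[ j < k * A ] stripCount (at j)
    μ≤S = ≤-trans (≤-trans (m≤m+n (size μ) k) (≤-reflexive (sym sizes))) λ≤S

  residueStrip : ℕ → ℕ
  residueStrip t = ∑[ i < A ] stripCount (at (k * i + t))

  -- Two cells with contents in the same residue class would force k + 1 cells with consecutive contents.
  residueStrip≤1 : ∀ t → t < k → residueStrip t ≤ 1
  residueStrip≤1 t t<k with 2 ≤? residueStrip t
  ... | no ≱2 = ≤-pred (≰⇒> ≱2)
  ... | yes ≥2 with ∑>1⇒∃₂ (λ i → stripCount (at (k * i + t))) A (λ i _ → stripCount≤1 (at (k * i + t))) ≥2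
  ...   | i , i′ , i<i′ , i′<A , pos , pos′ =
    ⊥-elim (<-irrefl refl (≤-trans (run≤∑ (λ j → stripCount (at j)) (k * A) (k * i + t) k inside run) (≤-reflexive ∑-stripCount)))
    where
    next : ∀ k i t → k * i + t + k ≡ k * suc i + t
    next = ℕ-Solver.solve-∀
    gap : k * i + t + k ≤ k * i′ + t
    gap = ≤-trans (≤-reflexive (next k i t)) (+-monoˡ-≤ t (*-monoʳ-≤ k i<i′))
    inside : k * i + t + k < k * A
    inside = ≤-<-trans gap (k*i+t<k*j k t<k i′<A)
    run : ∀ u → u ≤ k → 0 < stripCount (at (k * i + t + u))
    run u u≤k = stripCount-interval (at (k * i + t)) (at (k * i′ + t)) (at (k * i + t + u)) pos pos′
                  (at-mono (m≤m+n _ u)) (at-mono (≤-trans (+-monoʳ-≤ (k * i + t) u≤k) gap))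

  residueStrip≡1 : ∀ t → t < k → residueStrip t ≡ 1
  residueStrip≡1 = ∑≡n⇒≡1 residueStrip k residueStrip≤1 (trans (sym (∑-residues (stripCount ∘ at) k A)) ∑-stripCount)

  residueWindow-strip : ∀ t → t < k → residueWindow λ′ t ≡ residueWindow μ t + 1
  residueWindow-strip t t<k = begin
    residueWindow λ′ t
      ≡⟨ ∑-cong A (λ i _ → count-contents-strip (at (k * i + t))) ⟩
    ∑[ i < A ] (count (at (k * i + t)) (contents μ) + stripCount (at (k * i + t)))
      ≡⟨ ∑-+ _ _ A ⟩
    residueWindow μ t + residueStrip t
      ≡⟨ cong (_+_ (residueWindow μ t)) (residueStrip≡1 t t<k) ⟩
    residueWindow μ t + 1 ∎
    where open ≡-Reasoning

residueWindow-emptyCore : ∀ k .{{_ : NonZero k}} S λ′ → EmptyCore k λ′ → IsPartition λ′ → size λ′ ≤ S →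
  ∃[ n ] ∀ t → t < k → Window.residueWindow k S λ′ t ≡ n
residueWindow-emptyCore k S .[] ε _ _ = 0 , λ t _ → ∑-zero (Window.A k S)
residueWindow-emptyCore k S λ′ (_◅_ {j = μ} ((dμ , pμ) , μ⊆λ , sizes , connected , thin) rest) (dλ , pλ) λ≤S
  with residueWindow-emptyCore k S μ rest (dμ , pμ) (≤-trans (≤-trans (m≤m+n (size μ) k) (≤-reflexive (sym sizes))) λ≤S)
... | n , all-n = suc n , λ t t<k → trans (strip t t<k) (trans (cong (_+ 1) (all-n t t<k)) (+-comm n 1))
  where
  open StripWindow k S λ′ μ dλ pλ dμ pμ μ⊆λ sizes connected thin λ≤S renaming (residueWindow-strip to strip)

-- Summing count-μ over the class t gives residueWindow μ t = Φ t − P t, and Φ (t + 1) − Φ t = easts (subword k t W) M,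
-- P (t + 1) − P t = Q, while easts (subword k t W) M = M − norths (subword k t W).
module WordWindow (k : ℕ) .{{_ : NonZero k}} (S : ℕ) (W : List Bool) (L : ℕ) (L≤S : L ≤ S)
                  (shortW : length W ≤ k * S + S) (μ : List ℕ)
                  (count-μ : ∀ x → count x (contents μ) + x ⁺ ≡ easts W ((x ℤ.+ + (k * L)) ⁺)) where

  open Window k S
  open Subwords k using (easts-interleave; length-subword)

  Q M : ℕ
  Q = k * S + S + 1
  M = Q + L

  A≡S+Q : A ≡ S + Q
  A≡S+Q = ring k S
    where
    ring : ∀ k S → k * S + 2 * S + 1 ≡ S + (k * S + S + 1)
    ring = ℕ-Solver.solve-∀

  A≡[S∸L]+M : A ≡ (S ∸ L) + M
  A≡[S∸L]+M = begin
    A                  ≡⟨ A≡S+Q ⟩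
    S + Q              ≡⟨ cong (_+ Q) (sym (m∸n+n≡m L≤S)) ⟩
    (S ∸ L) + L + Q    ≡⟨ +-assoc (S ∸ L) L Q ⟩
    (S ∸ L) + (L + Q)  ≡⟨ cong (_+_ (S ∸ L)) (+-comm L Q) ⟩
    (S ∸ L) + M        ∎
    where open ≡-Reasoning

  Φ : ℕ → ℕ
  Φ t = ∑[ i < A ] easts W ((at (k * i + t) ℤ.+ + (k * L)) ⁺)

  P : ℕ → ℕ
  P t = ∑[ i < A ] ((at (k * i + t) ℤ.+ + 0) ⁺)

  residueWindow+P≡Φ : ∀ t → residueWindow μ t + P t ≡ Φ t
  residueWindow+P≡Φ t = trans (sym (∑-+ _ _ A)) (∑-cong A (λ i _ →
    trans (cong (λ x → count (at (k * i + t)) (contents μ) + x ⁺) (ℤₚ.+-identityʳ (at (k * i + t)))) (count-μ (at (k * i + t)))))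

  Φ≡ : ∀ t → t < k → Φ t ≡ ∑[ j < M ] easts W (k * j + t)
  Φ≡ t t<k = ∑-drop-negative (easts W) (easts-zero W) (S ∸ L) M (k * L) t t<k
    (trans (cong (_*_ k) (sym (m∸n+n≡m L≤S))) (*-distribˡ-+ k (S ∸ L) L)) A≡[S∸L]+M

  P≡ : ∀ t → t < k → P t ≡ ∑[ j < Q ] (k * j + t)
  P≡ t t<k = ∑-drop-negative id refl S Q 0 t t<k (sym (+-identityʳ (k * S))) A≡S+Q

  P-suc : ∀ t → suc t < k → P (suc t) ≡ P t + Q
  P-suc t 1+t<k = begin
    P (suc t)                            ≡⟨ P≡ (suc t) 1+t<k ⟩
    ∑[ j < Q ] (k * j + suc t)           ≡⟨ ∑-cong Q (λ j _ → trans (+-suc (k * j) t) (+-comm 1 _)) ⟩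
    ∑[ j < Q ] (k * j + t + 1)           ≡⟨ ∑-+ (λ j → k * j + t) (λ _ → 1) Q ⟩
    ∑[ j < Q ] (k * j + t) + ∑[ j < Q ] 1 ≡⟨ cong₂ _+_ (sym (P≡ t (<-trans (n<1+n t) 1+t<k))) (trans (∑-const 1 Q) (*-identityʳ Q)) ⟩
    P t + Q                              ∎
    where open ≡-Reasoning

  -- The letter of W at position k j + t is the letter of its t-th subword at position j.
  easts-letter : ∀ t → suc t < k → ∀ j →
    easts W (k * j + suc t) + easts (subword k t W) j ≡ easts W (k * j + t) + easts (subword k t W) (suc j)
  easts-letter t 1+t<k j = begin
    easts W (k * j + suc t) + easts (subword k t W) j
      ≡⟨ cong₂ _+_ (easts-interleave W j (suc t) (<⇒≤ 1+t<k)) (cong (easts (subword k t W)) (sym j+0)) ⟩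
    ∑< k after + before t
      ≡⟨ ∑-update before after t k t<k (λ s _ s≢t → cong (λ z → easts (subword k s W) (j + z)) (other s s≢t)) ⟩
    ∑< k before + after t
      ≡⟨ cong₂ _+_ (sym (easts-interleave W j t (<⇒≤ t<k))) (cong (easts (subword k t W)) j+1) ⟩
    easts W (k * j + t) + easts (subword k t W) (suc j) ∎
    where
    open ≡-Reasoning
    t<k = <-trans (n<1+n t) 1+t<k
    before after : ℕ → ℕ
    before s = easts (subword k s W) (j + 𝟙[ s < t ])
    after s = easts (subword k s W) (j + 𝟙[ s < suc t ])
    j+0 : j + 𝟙[ t < t ] ≡ j
    j+0 = trans (cong (_+_ j) (𝟙<-no (≤-refl {t}))) (+-identityʳ j)
    j+1 : j + 𝟙[ t < suc t ] ≡ suc j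
    j+1 = trans (cong (_+_ j) (𝟙<-yes (n<1+n t))) (+-comm j 1)
    other : ∀ s → s ≢ t → 𝟙[ s < suc t ] ≡ 𝟙[ s < t ]
    other s s≢t = trans (𝟙<-suc s t) (trans (cong (_+_ 𝟙[ s < t ]) (δ-≢ (s≢t ∘ ℤₚ.+-injective))) (+-identityʳ _))

  Φ-suc : ∀ t → suc t < k → Φ (suc t) ≡ Φ t + easts (subword k t W) M
  Φ-suc t 1+t<k = +-cancelʳ-≡ X _ _ (begin
    Φ (suc t) + X                                             ≡⟨ cong (_+ X) (Φ≡ (suc t) 1+t<k) ⟩
    ∑[ j < M ] easts W (k * j + suc t) + X                    ≡⟨ sym (∑-+ _ _ M) ⟩
    ∑[ j < M ] (easts W (k * j + suc t) + easts Wt j)         ≡⟨ ∑-cong M (λ j _ → easts-letter t 1+t<k j) ⟩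
    ∑[ j < M ] (easts W (k * j + t) + easts Wt (suc j))       ≡⟨ ∑-+ _ _ M ⟩
    ∑[ j < M ] easts W (k * j + t) + ∑[ j < M ] easts Wt (suc j) ≡⟨ cong₂ _+_ (sym (Φ≡ t t<k)) (∑-shift (easts Wt) M (easts-zero Wt)) ⟩
    Φ t + (X + easts Wt M)                                    ≡⟨ cong (_+_ (Φ t)) (+-comm X _) ⟩
    Φ t + (easts Wt M + X)                                    ≡⟨ sym (+-assoc (Φ t) _ X) ⟩
    Φ t + easts Wt M + X                                      ∎)
    where
    open ≡-Reasoning
    Wt = subword k t W
    X = ∑< M (easts Wt)
    t<k = <-trans (n<1+n t) 1+t<k

  residueWindow-step : ∀ t → suc t < k → residueWindow μ (suc t) + norths (subword k t W) ≡ residueWindow μ t + L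
  residueWindow-step t 1+t<k = +-cancelʳ-≡ (P t + Q) _ _ (begin
    R (suc t) + Z + (P t + Q)        ≡⟨ xy∙z≈xz∙y (R (suc t)) Z (P t + Q) ⟩
    R (suc t) + (P t + Q) + Z        ≡⟨ cong (λ z → R (suc t) + z + Z) (sym (P-suc t 1+t<k)) ⟩
    R (suc t) + P (suc t) + Z        ≡⟨ cong (_+ Z) (residueWindow+P≡Φ (suc t)) ⟩
    Φ (suc t) + Z                    ≡⟨ cong (_+ Z) (Φ-suc t 1+t<k) ⟩
    Φ t + easts Wt M + Z             ≡⟨ +-assoc (Φ t) _ Z ⟩
    Φ t + (easts Wt M + Z)           ≡⟨ cong (_+_ (Φ t)) (easts+norths Wt M short) ⟩
    Φ t + (Q + L)                    ≡⟨ cong (_+ (Q + L)) (sym (residueWindow+P≡Φ t)) ⟩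
    R t + P t + (Q + L)              ≡⟨ ring (R t) (P t) Q L ⟩
    R t + L + (P t + Q)              ∎)
    where
    open ≡-Reasoning
    R = residueWindow μ
    Wt = subword k t W
    Z = norths Wt
    ring : ∀ a b c d → a + b + (c + d) ≡ a + d + (b + c)
    ring = ℕ-Solver.solve-∀
    short : length Wt ≤ M
    short = ≤-trans (length-subword t W) (≤-trans shortW (≤-trans (m≤m+n (k * S + S) 1) (m≤m+n Q L)))

balanced-last : ∀ k (Z : ℕ → ℕ) L → (∀ t → suc t < k → Z t ≡ L) → ∑< k Z ≡ k * L → ∀ s → s < k → Z s ≡ L
balanced-last (suc k) Z L below total s s<1+k with s ≟ k
... | no s≢k = below s (s≤s (≤∧≢⇒< (≤-pred s<1+k) s≢k))
... | yes refl = +-cancelˡ-≡ (s * L) _ _ (trans (cong (_+ Z s) (sym (trans (∑-cong s (λ t t<s → below t (s≤s t<s))) (∑-const L s))))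
                                                 (trans total (+-comm L (s * L))))

balanced-emptyCore : ∀ k .{{_ : NonZero k}} λ′ → IsPartition λ′ → EmptyCore k λ′ → ∀ L → length (padZeros k λ′) ≡ k * L →
  Balanced k (boundaryWord (padZeros k λ′)) L
balanced-emptyCore k λ′ (dec , pos) empty L rows = balanced-last k (λ s → norths (subword k s W)) L all-but-last total
  where
  open Padded k λ′ dec L rows using (W; count-contents-padded)
  S = size λ′ + L
  padded = padZeros k λ′
  pad = (k ∸ length λ′ % k) % k
  shortW : length W ≤ k * S + S
  shortW = begin
    length W                  ≤⟨ length-boundaryWord padded (size λ′) (decreasing-padded λ′ pad dec) parts≤ ⟩
    length padded + size λ′   ≡⟨ cong (_+ size λ′) rows ⟩
    k * L + size λ′           ≤⟨ +-mono-≤ (*-monoʳ-≤ k (m≤n+m L (size λ′))) (m≤m+n (size λ′) L) ⟩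
    k * S + S                 ∎
    where
    open ≤-Reasoning
    zeros : ∀ m → All (_≤ size λ′) (replicate m 0)
    zeros zero = []
    zeros (suc m) = z≤n ∷ zeros m
    parts≤ : All (_≤ size λ′) padded
    parts≤ = AllP.++⁺ (parts≤size λ′) (zeros pad)
  open Window k S using (residueWindow)
  open WordWindow k S W L (m≤n+m L (size λ′)) shortW λ′ count-contents-padded using (residueWindow-step)
  all-but-last : ∀ t → suc t < k → norths (subword k t W) ≡ L
  all-but-last t 1+t<k with residueWindow-emptyCore k S λ′ empty (dec , pos) (m≤m+n (size λ′) L)
  ... | n , all-n = +-cancelˡ-≡ n _ _ (begin
    n + norths (subword k t W)                    ≡⟨ cong (_+ norths (subword k t W)) (sym (all-n (suc t) 1+t<k)) ⟩
    residueWindow λ′ (suc t) + norths (subword k t W) ≡⟨ residueWindow-step t 1+t<k ⟩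
    residueWindow λ′ t + L                        ≡⟨ cong (_+ L) (all-n t (<-trans (n<1+n t) 1+t<k)) ⟩
    n + L                                         ∎)
    where open ≡-Reasoning
  total : ∑[ s < k ] norths (subword k s W) ≡ k * L
  total = trans (norths-subwords k W) (trans (norths-boundaryWord padded) rows)

proposition3p4 : (k : ℕ) → .{{_ : NonZero k}} → (λ′ : List ℕ) → IsPartition λ′ →
    EmptyCore k λ′ → (r : ℕ) → r < k → lhs k r λ′ ↭ rhs k r λ′
proposition3p4 k λ′ (dec , pos) empty r r<k with padded-length k λ′
... | L , rows = count⇒↭ (lhs k r λ′) (rhs k r λ′)
  (Padded.count-lhs≡count-rhs k λ′ dec L rows (balanced-emptyCore k λ′ (dec , pos) empty L rows) r r<k)
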